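{- Let $n$ and $k$ be positive integers. If $n\equiv 0,1\pmod 4$ and $n\ge 2k+6$, or if $n\equiv 2,3\pmod 4$ and $n\ge 2k+4$, then for each choice of sign $\epsilon\in\{+,-\}$, $$1^kR^{\epsilon}_{n,1}+3^kR^{\epsilon}_{n,3}+5^kR^{\epsilon}_{n,5}+\cdots=2^kR^{\epsilon}_{n,2}+4^kR^{\epsilon}_{n,4}+6^kR^{\epsilon}_{n,6}+\cdots.$$
   Context: For $\pi=\pi_1\cdots\pi_n\in\mathfrak{S}_n$, let $\mathrm{inv}(\pi)=|\{i<j:\pi_i>\pi_j\}|$; let $\mathrm{pk}(\pi)$ (resp. $\mathrm{val}(\pi)$) be the number of indices $2\le i\le n-1$ with $\pi_{i-1}<\pi_i>\pi_{i+1}$ (resp. $\pi_{i-1}>\pi_i<\pi_{i+1}$), and $\mathrm{altruns}(\pi)=\mathrm{pk}(\pi)+\mathrm{val}(\pi)+1$. Let $\mathcal{A}_n$ be the set of permutations with an even number of inversions. Let $R^+_{n,j}$ be the number of $\pi\in\mathcal{A}_n$ with $\mathrm{altruns}(\pi)=j$, and $R^-_{n,j}$ the number of $\pi\in\mathfrak{S}_n\setminus\mathcal{A}_n$ with $\mathrm{altruns}(\pi)=j$. -}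

module Defs where

open import Data.Nat using (ℕ; zero; suc; _+_; _*_; _^_; _<ᵇ_; _≡ᵇ_; _%_)
open import Data.Bool using (Bool; true; false; if_then_else_; not; _∧_; _∨_)
open import Data.List using (List; []; _∷_; map; concatMap; filter; length; upTo)
open import Data.Nat.ListAction using (sum)
open import Data.Bool.Properties using (T?)

words : (n m : ℕ) → List (List ℕ)
words n zero = [] ∷ []
words n (suc m) = concatMap (λ w → map (λ a → a ∷ w) (upTo n)) (words n m)

notIn : ℕ → List ℕ → Bool
notIn a [] = true
notIn a (b ∷ bs) = not (a ≡ᵇ b) ∧ notIn a bs

distinct : List ℕ → Bool
distinct [] = true
distinct (a ∷ as) = notIn a as ∧ distinct as

-- The symmetric group S_n, realised as the list of all permutations
-- π = π₁⋯πₙ of {0,…,n-1} in one-line notation (injective words of length n).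
perms : ℕ → List (List ℕ)
perms n = filter (λ w → T? (distinct w)) (words n n)

countLess : ℕ → List ℕ → ℕ
countLess a [] = 0
countLess a (b ∷ bs) = (if b <ᵇ a then 1 else 0) + countLess a bs

inv : List ℕ → ℕ
inv [] = 0
inv (a ∷ as) = countLess a as + inv as

pkval : List ℕ → ℕ
pkval (a ∷ b ∷ c ∷ rest) =
  (if ((a <ᵇ b) ∧ (c <ᵇ b)) ∨ ((b <ᵇ a) ∧ (b <ᵇ c)) then 1 else 0)
  + pkval (b ∷ c ∷ rest)
pkval _ = 0

altruns : List ℕ → ℕ
altruns π = pkval π + 1

isEven : ℕ → Bool
isEven m = m % 2 ≡ᵇ 0

-- sign ε : true = '+', false = '-'
-- inClass ε π : π ∈ 𝒜ₙ (ε = +) or π ∈ 𝔖ₙ ∖ 𝒜ₙ (ε = -)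
inClass : Bool → List ℕ → Bool
inClass true π = isEven (inv π)
inClass false π = not (isEven (inv π))

R : Bool → ℕ → ℕ → ℕ
R ε n j = length (filter (λ π → T? (inClass ε π ∧ (altruns π ≡ᵇ j))) (perms n))

-- Σ_{j odd, 1 ≤ j ≤ n} j^k R^ε_{n,j}   and the even analogue
-- (R^ε_{n,j} = 0 for j > n, so these finite sums are the full series)
oddSum : Bool → ℕ → ℕ → ℕ
oddSum ε n k = sum (map (λ j → if isEven j then 0 else j ^ k * R ε n j) (map suc (upTo n)))

evenSum : Bool → ℕ → ℕ → ℕ
evenSum ε n k = sum (map (λ j → if isEven j then j ^ k * R ε n j else 0) (map suc (upTo n)))

-- oddSum − evenSum = −Σ (−1)^altruns(π) · altruns(π)^k over the parity class. Write altruns π = 1 + Σᵢ tᵢ(π),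
-- where tᵢ indicates a peak or valley at position i + 1, and expand the k-th power: it suffices that
-- Σ_π (Πℓ∈L tℓ(π)) · (−1)^(pk + val)(π) vanishes over the class for every list L of at most k positions, and
-- (−1)^(pk + val)(π) is the product of the signs of the first and the last step of π.
-- Over all of 𝔖ₙ this sum vanishes: choose an odd position j ≤ 2k + 1 with j, j − 1 ∉ L and replace π₀ … πⱼ
-- by the values of complementary rank among them. This fixes every tℓ with ℓ ∈ L and the last step but
-- reverses the first step. It remains to exchange the two parity classes by a weight-preserving involution.
-- For n ≡ 2, 3 (mod 4), π ↦ n − 1 − π changes inv by n(n − 1)/2 − 2 inv π, which is odd. For n ≡ 0, 1 (mod 4),
-- transpose the values 2m and 2m + 1 for the least m ≤ k + 2 such that they are not adjacent at the first
-- or last step or inside a turn window of L; this changes inv by one and preserves the weight.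

module Submission where

open import Defs
open import Data.Nat using (ℕ; _≤_; _+_; _*_; _%_)
open import Data.Bool using (Bool)
open import Data.Sum using (_⊎_)
open import Data.Product using (_×_)
open import Relation.Binary.PropositionalEquality using (_≡_)

open import Data.Nat as ℕ using (zero; suc; ⌊_/2⌋; _<_; z≤n; s≤s; _<ᵇ_; _≡ᵇ_; _∸_; _^_; _/_)
import Data.Nat.Properties as ℕP
open import Data.Nat.DivMod using ([m+n]%n≡m%n; m≡m%n+[m/n]*n)
open import Data.Nat.ListAction using (sum)
open import Data.Integer as ℤ using (ℤ; +_; -_; -[1+_]) renaming (_+_ to _⊕_; _*_ to _⊗_)
import Data.Integer.Properties as ℤP
open import Data.Integer.Tactic.RingSolver using (solve-∀)
open import Data.Nat.Tactic.RingSolver using () renaming (solve-∀ to ℕ-solve-∀)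
open import Data.Bool using (true; false; not; _∧_; _∨_; T; if_then_else_)
import Data.Bool.Properties as BP
open import Data.Bool.Properties using (T?)
open import Data.Unit using (tt)
open import Data.Empty using (⊥-elim)
open import Data.Maybe using (Maybe; just; nothing)
open import Data.Sum using (inj₁; inj₂)
open import Data.Product using (_,_; proj₁; proj₂; ∃)
open import Data.List using (List; []; _∷_; [_]; map; _++_; length; filter; upTo; applyUpTo; take; drop)
import Data.List.Properties as LP
open import Data.List.Membership.Propositional using (_∈_; _∉_; find)
open import Data.List.Membership.Propositional.Properties
  using (∈-map⁺; ∈-map⁻; ∈-concat⁻′; ∈-concat⁺′; ∈-filter⁺; ∈-filter⁻; ∈-upTo⁺; ∈-upTo⁻; ∈-∃++; ∈-++⁻; ∈-++⁺ˡ; ∈-++⁺ʳ)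
open import Data.List.Membership.Propositional.Properties.WithK using (unique∧set⇒bag)
open import Data.List.Membership.DecPropositional ℕP._≟_ using (_∈?_)
open import Data.List.Relation.Unary.Any using (here; there)
open import Data.List.Relation.Unary.All as All using (All; []; _∷_)
import Data.List.Relation.Unary.All.Properties as AllP
open import Data.List.Relation.Unary.AllPairs using (AllPairs; []; _∷_)
import Data.List.Relation.Unary.AllPairs.Properties as AllPairsP
open import Data.List.Relation.Unary.Unique.Propositional using (Unique)
import Data.List.Relation.Unary.Unique.Propositional.Properties as UniqueP
open import Data.List.Relation.Binary.Permutation.Propositional
  using (_↭_; prep; swap; ↭-sym) renaming (refl to ↭-refl; trans to ↭-trans)
import Data.List.Relation.Binary.Permutation.Propositional.Properties as ↭P
open import Data.List.Relation.Binary.BagAndSetEquality using (∼bag⇒↭)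
open import Function.Bundles using (mk⇔)
open import Relation.Binary using (tri<; tri≈; tri>)
open import Relation.Binary.PropositionalEquality using (refl; sym; trans; cong; cong₂; subst; subst₂; _≢_; module ≡-Reasoning)
open import Relation.Nullary using (¬_; yes; no)

∑ : {A : Set} → (A → ℤ) → List A → ℤ
∑ f [] = + 0
∑ f (x ∷ xs) = f x ⊕ ∑ f xs

∑-++ : {A : Set} (f : A → ℤ) (xs ys : List A) → ∑ f (xs ++ ys) ≡ ∑ f xs ⊕ ∑ f ys
∑-++ f [] ys = sym (ℤP.+-identityˡ _)
∑-++ f (x ∷ xs) ys = trans (cong (f x ⊕_) (∑-++ f xs ys)) (sym (ℤP.+-assoc (f x) _ _))

∑-↭ : {A : Set} (f : A → ℤ) {xs ys : List A} → xs ↭ ys → ∑ f xs ≡ ∑ f ys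
∑-↭ f ↭-refl = refl
∑-↭ f (prep x p) = cong (f x ⊕_) (∑-↭ f p)
∑-↭ f (swap x y p) =
  trans (sym (ℤP.+-assoc (f x) (f y) _))
  (trans (cong₂ _⊕_ (ℤP.+-comm (f x) (f y)) (∑-↭ f p)) (ℤP.+-assoc (f y) (f x) _))
∑-↭ f (↭-trans p q) = trans (∑-↭ f p) (∑-↭ f q)

∑-map : {A B : Set} (f : B → ℤ) (g : A → B) (xs : List A) → ∑ f (map g xs) ≡ ∑ (λ x → f (g x)) xs
∑-map f g [] = refl
∑-map f g (x ∷ xs) = cong (f (g x) ⊕_) (∑-map f g xs)

∑-cong : {A : Set} {f g : A → ℤ} (xs : List A) → (∀ x → x ∈ xs → f x ≡ g x) → ∑ f xs ≡ ∑ g xs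
∑-cong [] h = refl
∑-cong (x ∷ xs) h = cong₂ _⊕_ (h x (here refl)) (∑-cong xs (λ y y∈ → h y (there y∈)))

∑-+ : {A : Set} (f g : A → ℤ) (xs : List A) → ∑ (λ x → f x ⊕ g x) xs ≡ ∑ f xs ⊕ ∑ g xs
∑-+ f g [] = refl
∑-+ f g (x ∷ xs) = trans (cong (f x ⊕ g x ⊕_) (∑-+ f g xs)) (interchange (f x) (g x) (∑ f xs) (∑ g xs))
  where
  interchange : ∀ a b c d → (a ⊕ b) ⊕ (c ⊕ d) ≡ (a ⊕ c) ⊕ (b ⊕ d)
  interchange = solve-∀

∑-*ˡ : {A : Set} (c : ℤ) (f : A → ℤ) (xs : List A) → ∑ (λ x → c ⊗ f x) xs ≡ c ⊗ ∑ f xs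
∑-*ˡ c f [] = sym (ℤP.*-zeroʳ c)
∑-*ˡ c f (x ∷ xs) = trans (cong (c ⊗ f x ⊕_) (∑-*ˡ c f xs)) (sym (ℤP.*-distribˡ-+ c (f x) _))

∑-neg : {A : Set} (f : A → ℤ) (xs : List A) → ∑ (λ x → - f x) xs ≡ - ∑ f xs
∑-neg f [] = refl
∑-neg f (x ∷ xs) = trans (cong (- f x ⊕_) (∑-neg f xs)) (sym (ℤP.neg-distrib-+ (f x) _))

∑-zero : {A : Set} (f : A → ℤ) (xs : List A) → (∀ x → x ∈ xs → f x ≡ + 0) → ∑ f xs ≡ + 0
∑-zero f [] h = refl
∑-zero f (x ∷ xs) h = cong₂ _⊕_ (h x (here refl)) (∑-zero f xs (λ y y∈ → h y (there y∈)))

∑-comm : {A B : Set} (F : A → B → ℤ) (xs : List A) (ys : List B) →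
  ∑ (λ x → ∑ (F x) ys) xs ≡ ∑ (λ y → ∑ (λ x → F x y) xs) ys
∑-comm F [] ys = sym (∑-zero _ ys (λ _ _ → refl))
∑-comm F (x ∷ xs) ys = trans (cong (∑ (F x) ys ⊕_) (∑-comm F xs ys))
  (sym (∑-+ (F x) (λ y → ∑ (λ x′ → F x′ y) xs) ys))

x≡-x⇒x≡0 : (x : ℤ) → x ≡ - x → x ≡ + 0
x≡-x⇒x≡0 (+ zero) e = refl
x≡-x⇒x≡0 (+ suc n) ()
x≡-x⇒x≡0 -[1+ n ] ()

x+x≡0⇒x≡0 : (x : ℤ) → x ⊕ x ≡ + 0 → x ≡ + 0
x+x≡0⇒x≡0 (+ zero) e = refl
x+x≡0⇒x≡0 (+ suc n) ()
x+x≡0⇒x≡0 -[1+ n ] ()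

Unique-map⁺-injectiveOn : {A B : Set} (φ : A → B) (xs : List A) → Unique xs →
  (∀ x y → x ∈ xs → y ∈ xs → φ x ≡ φ y → x ≡ y) → Unique (map φ xs)
Unique-map⁺-injectiveOn φ [] u inj = []
Unique-map⁺-injectiveOn φ (x ∷ xs) (x∉ ∷ u) inj =
  distinctImages xs x∉ (λ y y∈ → inj x y (here refl) (there y∈))
  ∷ Unique-map⁺-injectiveOn φ xs u (λ a b a∈ b∈ → inj a b (there a∈) (there b∈))
  where
  distinctImages : (ys : List _) → All (x ≢_) ys → (∀ y → y ∈ ys → φ x ≡ φ y → x ≡ y) → All (φ x ≢_) (map φ ys)
  distinctImages [] [] h = []
  distinctImages (y ∷ ys) (p ∷ ps) h = (λ e → p (h y (here refl) e)) ∷ distinctImages ys ps (λ z z∈ → h z (there z∈))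

module _ {A : Set} (φ : A → A) (xs : List A) (unique : Unique xs)
         (closed : ∀ x → x ∈ xs → φ x ∈ xs) (involutive : ∀ x → x ∈ xs → φ (φ x) ≡ x) where

  map-involution-↭ : map φ xs ↭ xs
  map-involution-↭ = ∼bag⇒↭ (unique∧set⇒bag uniqueImage unique (mk⇔ to from))
    where
    uniqueImage : Unique (map φ xs)
    uniqueImage = Unique-map⁺-injectiveOn φ xs unique
      (λ x y x∈ y∈ e → trans (sym (involutive x x∈)) (trans (cong φ e) (involutive y y∈)))
    to : ∀ {z} → z ∈ map φ xs → z ∈ xs
    to z∈ with ∈-map⁻ φ z∈
    ... | x , x∈ , refl = closed x x∈
    from : ∀ {z} → z ∈ xs → z ∈ map φ xs
    from {z} z∈ = subst (_∈ map φ xs) (involutive z z∈) (∈-map⁺ φ (closed z z∈))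

  ∑-involution : (f : A → ℤ) → ∑ f xs ≡ ∑ (λ x → f (φ x)) xs
  ∑-involution f = trans (sym (∑-↭ f map-involution-↭)) (∑-map f φ xs)

  ∑-signReversing≡0 : (f : A → ℤ) → (∀ x → x ∈ xs → f (φ x) ≡ - f x) → ∑ f xs ≡ + 0
  ∑-signReversing≡0 f reverses =
    x≡-x⇒x≡0 _ (trans (∑-involution f) (trans (∑-cong xs reverses) (∑-neg f xs)))

T⇒≡true : ∀ {b} → T b → b ≡ true
T⇒≡true {true} _ = refl

¬T⇒≡false : ∀ {b} → ¬ T b → b ≡ false
¬T⇒≡false {false} _ = refl
¬T⇒≡false {true} p = ⊥-elim (p tt)

T-∧ˡ : ∀ {a b} → T (a ∧ b) → T a
T-∧ˡ {true} _ = tt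

T-∧ʳ : ∀ {a b} → T (a ∧ b) → T b
T-∧ʳ {true} p = p

T-∧-intro : ∀ {a b} → T a → T b → T (a ∧ b)
T-∧-intro {true} _ q = q

T-∨⁻ : ∀ {a b} → T (a ∨ b) → T a ⊎ T b
T-∨⁻ {true} _ = inj₁ tt
T-∨⁻ {false} p = inj₂ p

T-∨⁺ˡ : ∀ {a b} → T a → T (a ∨ b)
T-∨⁺ˡ {true} _ = tt

T-∨⁺ʳ : ∀ {a b} → T b → T (a ∨ b)
T-∨⁺ʳ {true} _ = tt
T-∨⁺ʳ {false} p = p

T-not⁻ : ∀ {a} → T (not a) → ¬ T a
T-not⁻ {false} _ ()

T-not⁺ : ∀ {a} → ¬ T a → T (not a)
T-not⁺ {a} p rewrite ¬T⇒≡false p = tt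

T-not∨⁻ : ∀ {p f} → T (not p ∨ f) → ¬ T f → ¬ T p
T-not∨⁻ {true} {true} _ nf _ = nf tt

≡⇒≡ᵇ≡true : ∀ {x y} → x ≡ y → (x ≡ᵇ y) ≡ true
≡⇒≡ᵇ≡true {x} refl = T⇒≡true (ℕP.≡⇒≡ᵇ x x refl)

≢⇒≡ᵇ≡false : ∀ {x y} → x ≢ y → (x ≡ᵇ y) ≡ false
≢⇒≡ᵇ≡false {x} {y} ne = ¬T⇒≡false (λ p → ne (ℕP.≡ᵇ⇒≡ x y p))

≡ᵇ≡true⇒≡ : ∀ {x y} → (x ≡ᵇ y) ≡ true → x ≡ y
≡ᵇ≡true⇒≡ {x} {y} e = ℕP.≡ᵇ⇒≡ x y (subst T (sym e) tt)

<⇒<ᵇ≡true : ∀ {x y} → x < y → (x <ᵇ y) ≡ true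
<⇒<ᵇ≡true x<y = T⇒≡true (ℕP.<⇒<ᵇ x<y)

≮⇒<ᵇ≡false : ∀ {x y} → ¬ x < y → (x <ᵇ y) ≡ false
≮⇒<ᵇ≡false {x} {y} x≮y = ¬T⇒≡false (λ p → x≮y (ℕP.<ᵇ⇒< x y p))

n<ᵇn≡false : ∀ x → (x <ᵇ x) ≡ false
n<ᵇn≡false x = ≮⇒<ᵇ≡false {x} (ℕP.<-irrefl refl)

<ᵇ-flip : ∀ a b → a ≢ b → (b <ᵇ a) ≡ not (a <ᵇ b)
<ᵇ-flip a b a≢b with ℕP.<-cmp a b
... | tri< a<b _ _ rewrite <⇒<ᵇ≡true a<b = ≮⇒<ᵇ≡false (ℕP.<-asym a<b)
... | tri≈ _ e _ = ⊥-elim (a≢b e)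
... | tri> _ _ b<a rewrite <⇒<ᵇ≡true b<a | ≮⇒<ᵇ≡false (ℕP.<-asym b<a) = refl

record IsPerm (n : ℕ) (π : List ℕ) : Set where
  constructor isPerm
  field
    len : length π ≡ n
    bnd : All (_< n) π
    unq : Unique π

notIn⇒All≢ : ∀ a bs → T (notIn a bs) → All (a ≢_) bs
notIn⇒All≢ a [] p = []
notIn⇒All≢ a (b ∷ bs) p = (λ e → T-not⁻ (T-∧ˡ p) (ℕP.≡⇒≡ᵇ a b e)) ∷ notIn⇒All≢ a bs (T-∧ʳ p)

All≢⇒notIn : ∀ a bs → All (a ≢_) bs → T (notIn a bs)
All≢⇒notIn a [] [] = tt
All≢⇒notIn a (b ∷ bs) (p ∷ ps) =
  T-∧-intro (T-not⁺ (λ q → p (ℕP.≡ᵇ⇒≡ a b q))) (All≢⇒notIn a bs ps)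

distinct⇒Unique : ∀ xs → T (distinct xs) → Unique xs
distinct⇒Unique [] p = []
distinct⇒Unique (x ∷ xs) p = notIn⇒All≢ x xs (T-∧ˡ p) ∷ distinct⇒Unique xs (T-∧ʳ {notIn x xs} p)

Unique⇒distinct : ∀ xs → Unique xs → T (distinct xs)
Unique⇒distinct [] [] = tt
Unique⇒distinct (x ∷ xs) (p ∷ ps) = T-∧-intro (All≢⇒notIn x xs p) (Unique⇒distinct xs ps)

∈-words⁻ : ∀ n m w → w ∈ words n m → length w ≡ m × All (_< n) w
∈-words⁻ n zero .[] (here refl) = refl , []
∈-words⁻ n (suc m) w w∈ with ∈-concat⁻′ (map (λ w → map (λ a → a ∷ w) (upTo n)) (words n m)) w∈
... | block , w∈block , block∈ with ∈-map⁻ _ block∈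
... | w′ , w′∈ , refl with ∈-map⁻ _ w∈block
... | a , a∈ , refl with ∈-words⁻ n m w′ w′∈
... | l , bounded = cong suc l , ∈-upTo⁻ a∈ ∷ bounded

∈-words⁺ : ∀ n m w → length w ≡ m → All (_< n) w → w ∈ words n m
∈-words⁺ n zero [] refl [] = here refl
∈-words⁺ n (suc m) (a ∷ w) l (a< ∷ bounded) =
  ∈-concat⁺′ (∈-map⁺ (λ a → a ∷ w) (∈-upTo⁺ a<))
    (∈-map⁺ (λ w → map (λ a → a ∷ w) (upTo n)) (∈-words⁺ n m w (ℕP.suc-injective l) bounded))

words-unique : ∀ n m → Unique (words n m)
words-unique n zero = [] ∷ []
words-unique n (suc m) =
  UniqueP.concat⁺ blocksUnique (AllPairsP.map⁺ (blocksDisjoint (words n m) (words-unique n m)))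
  where
  block : List ℕ → List (List ℕ)
  block w = map (λ a → a ∷ w) (upTo n)
  blocksUnique : All Unique (map block (words n m))
  blocksUnique = AllP.map⁺ (All.tabulate (λ _ → UniqueP.map⁺ (λ { refl → refl }) (UniqueP.upTo⁺ n)))
  disjoint : ∀ u v → u ≢ v → ∀ {z} → ¬ (z ∈ block u × z ∈ block v)
  disjoint u v u≢v (z∈u , z∈v) with ∈-map⁻ _ z∈u | ∈-map⁻ _ z∈v
  ... | _ , _ , refl | _ , _ , e = u≢v (cong (drop 1) e)
  blocksDisjoint : (ws : List (List ℕ)) → Unique ws → AllPairs (λ u v → ∀ {z} → ¬ (z ∈ block u × z ∈ block v)) ws
  blocksDisjoint [] [] = []
  blocksDisjoint (w ∷ ws) (w∉ ∷ u) =
    All.map (λ {v} w≢v {z} → disjoint w v w≢v {z}) w∉ ∷ blocksDisjoint ws u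

∈-perms⁻ : ∀ n π → π ∈ perms n → IsPerm n π
∈-perms⁻ n π π∈ with ∈-filter⁻ (λ w → T? (distinct w)) {xs = words n n} π∈
... | w∈ , d with ∈-words⁻ n n π w∈
... | l , b = isPerm l b (distinct⇒Unique π d)

∈-perms⁺ : ∀ n π → IsPerm n π → π ∈ perms n
∈-perms⁺ n π (isPerm l b u) =
  ∈-filter⁺ (λ w → T? (distinct w)) (∈-words⁺ n n π l b) (Unique⇒distinct π u)

perms-unique : ∀ n → Unique (perms n)
perms-unique n = UniqueP.filter⁺ (λ w → T? (distinct w)) (words-unique n n)

𝟙 : Bool → ℕ
𝟙 b = if b then 1 else 0

isTurn : ℕ → ℕ → ℕ → Bool
isTurn a b c = ((a <ᵇ b) ∧ (c <ᵇ b)) ∨ ((b <ᵇ a) ∧ (b <ᵇ c))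

-- turnAt π i is 1 iff π has a peak or a valley at (0-based) index i + 1.
turnAt : List ℕ → ℕ → ℕ
turnAt [] _ = 0
turnAt (_ ∷ π) (suc i) = turnAt π i
turnAt (a ∷ b ∷ c ∷ _) zero = 𝟙 (isTurn a b c)
turnAt _ zero = 0

pkval≡∑turnAt : ∀ π → + pkval π ≡ ∑ (λ i → + turnAt π i) (upTo (length π ∸ 2))
pkval≡∑turnAt [] = refl
pkval≡∑turnAt (a ∷ []) = refl
pkval≡∑turnAt (a ∷ b ∷ []) = refl
pkval≡∑turnAt (a ∷ b ∷ c ∷ r) =
  trans (ℤP.pos-+ (𝟙 (isTurn a b c)) _)
  (cong (+ 𝟙 (isTurn a b c) ⊕_) (trans (pkval≡∑turnAt (b ∷ c ∷ r)) (sym ∑-shift)))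
  where
  ∑-shift : ∑ (λ i → + turnAt (a ∷ b ∷ c ∷ r) i) (applyUpTo suc (length r))
          ≡ ∑ (λ i → + turnAt (b ∷ c ∷ r) i) (upTo (length r))
  ∑-shift = trans (cong (∑ _) (sym (LP.map-upTo suc (length r)))) (∑-map _ suc (upTo (length r)))

pkval≤length : ∀ a π → pkval (a ∷ π) ≤ length π
pkval≤length a [] = z≤n
pkval≤length a (b ∷ []) = z≤n
pkval≤length a (b ∷ c ∷ r) = ℕP.+-mono-≤ (𝟙≤1 (isTurn a b c)) (pkval≤length b (c ∷ r))
  where
  𝟙≤1 : ∀ x → 𝟙 x ≤ 1
  𝟙≤1 true = s≤s z≤n
  𝟙≤1 false = z≤n

sign : Bool → ℤ
sign true = + 1
sign false = - (+ 1)

sign-not : ∀ b → sign (not b) ≡ - sign b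
sign-not true = refl
sign-not false = refl

sign² : ∀ x → sign x ⊗ sign x ≡ + 1
sign² true = refl
sign² false = refl

−1^_ : ℕ → ℤ
−1^ zero = + 1
−1^ suc m = - (−1^ m)

−1^-+ : ∀ a b → −1^ (a + b) ≡ (−1^ a) ⊗ (−1^ b)
−1^-+ zero b = sym (ℤP.*-identityˡ _)
−1^-+ (suc a) b = trans (cong -_ (−1^-+ a b)) (ℤP.neg-distribˡ-* (−1^ a) (−1^ b))

−1^-isEven : ∀ j → −1^ j ≡ (if isEven j then + 1 else - (+ 1))
−1^-isEven zero = refl
−1^-isEven (suc zero) = refl
−1^-isEven (suc (suc j)) = trans (ℤP.neg-involutive (−1^ j)) (trans (−1^-isEven j)
  (cong (λ r → if r ℕ.≡ᵇ 0 then + 1 else - (+ 1)) (sym (trans (cong (_% 2) (ℕP.+-comm 2 j)) ([m+n]%n≡m%n j 2)))))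

firstAscent : List ℕ → Bool
firstAscent (a ∷ b ∷ _) = a <ᵇ b
firstAscent _ = true

lastAscent : List ℕ → Bool
lastAscent (a ∷ b ∷ []) = a <ᵇ b
lastAscent (_ ∷ b ∷ c ∷ r) = lastAscent (b ∷ c ∷ r)
lastAscent _ = true

endSign : List ℕ → ℤ
endSign π = sign (firstAscent π) ⊗ sign (lastAscent π)

−1^isTurn : ∀ a b c → a ≢ b → b ≢ c → −1^ 𝟙 (isTurn a b c) ≡ sign (a <ᵇ b) ⊗ sign (b <ᵇ c)
−1^isTurn a b c a≢b b≢c rewrite <ᵇ-flip a b a≢b | <ᵇ-flip b c b≢c with a <ᵇ b | b <ᵇ c
... | true | true = refl
... | true | false = refl
... | false | true = refl
... | false | false = refl

−1^pkval≡endSign : ∀ π → Unique π → 2 ≤ length π → −1^ pkval π ≡ endSign π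
−1^pkval≡endSign (a ∷ []) _ (s≤s ())
−1^pkval≡endSign (a ∷ b ∷ []) _ _ = sym (sign² (a <ᵇ b))
−1^pkval≡endSign (a ∷ b ∷ c ∷ r) ((a∉ ∷ _) ∷ u@((b∉ ∷ _) ∷ _)) _ =
  trans (−1^-+ (𝟙 (isTurn a b c)) _)
  (trans (cong₂ _⊗_ (−1^isTurn a b c a∉ b∉) (−1^pkval≡endSign (b ∷ c ∷ r) u (s≤s (s≤s z≤n))))
  (cancelMiddle (sign (a <ᵇ b)) (sign (b <ᵇ c)) (sign (lastAscent (b ∷ c ∷ r))) (sign² (b <ᵇ c))))
  where
  reassoc : ∀ x y z → (x ⊗ y) ⊗ (y ⊗ z) ≡ x ⊗ ((y ⊗ y) ⊗ z)
  reassoc = solve-∀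
  cancelMiddle : ∀ x y z → y ⊗ y ≡ + 1 → (x ⊗ y) ⊗ (y ⊗ z) ≡ x ⊗ z
  cancelMiddle x y z y²≡1 =
    trans (reassoc x y z) (cong (x ⊗_) (trans (cong (_⊗ z) y²≡1) (ℤP.*-identityˡ z)))

-- Expanding altruns^k into products of turn indicators

𝟙ℤ : Bool → ℤ
𝟙ℤ b = if b then + 1 else + 0

inClassℤ : Bool → List ℕ → ℤ
inClassℤ ε π = 𝟙ℤ (inClass ε π)

turnProduct : List ℕ → List ℕ → ℤ
turnProduct [] π = + 1
turnProduct (ℓ ∷ L) π = + turnAt π ℓ ⊗ turnProduct L π

term : Bool → List ℕ → ℕ → List ℕ → ℤ
term ε L m π = inClassℤ ε π ⊗ (turnProduct L π ⊗ (−1^ altruns π ⊗ + (altruns π ^ m)))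

moment : Bool → ℕ → List ℕ → ℕ → ℤ
moment ε n L m = ∑ (term ε L m) (perms n)

endMoment : Bool → ℕ → List ℕ → ℤ
endMoment ε n L = ∑ (λ π → inClassℤ ε π ⊗ (turnProduct L π ⊗ endSign π)) (perms n)

term-suc : ∀ ε n L m π → length π ≡ n →
  term ε L (suc m) π ≡ term ε L m π ⊕ ∑ (λ i → term ε (i ∷ L) m π) (upTo (n ∸ 2))
term-suc ε n L m π refl = begin
  c ⊗ (p ⊗ (s ⊗ + (A ℕ.* A ^ m)))
    ≡⟨ cong (λ z → c ⊗ (p ⊗ (s ⊗ z))) (ℤP.pos-* A (A ^ m)) ⟩
  c ⊗ (p ⊗ (s ⊗ (+ A ⊗ + (A ^ m))))
    ≡⟨ pullOut c p s (+ A) (+ (A ^ m)) ⟩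
  t ⊗ + A
    ≡⟨ cong (t ⊗_) (trans (ℤP.pos-+ (pkval π) 1) (cong (_⊕ + 1) (pkval≡∑turnAt π))) ⟩
  t ⊗ (∑ turns I ⊕ + 1)
    ≡⟨ distrib t (∑ turns I) ⟩
  t ⊕ t ⊗ ∑ turns I
    ≡⟨ cong (t ⊕_) (sym (∑-*ˡ t turns I)) ⟩
  t ⊕ ∑ (λ i → t ⊗ turns i) I
    ≡⟨ cong (t ⊕_) (∑-cong I (λ i _ → pushIn c p (+ turnAt π i) w)) ⟩
  t ⊕ ∑ (λ i → term ε (i ∷ L) m π) I ∎
  where
  open ≡-Reasoning
  A = altruns π
  c = inClassℤ ε π
  p = turnProduct L π
  s = −1^ A
  w = s ⊗ + (A ^ m)
  t = term ε L m π
  I = upTo (length π ∸ 2)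
  turns : ℕ → ℤ
  turns i = + turnAt π i
  pullOut : ∀ c p s a x → c ⊗ (p ⊗ (s ⊗ (a ⊗ x))) ≡ (c ⊗ (p ⊗ (s ⊗ x))) ⊗ a
  pullOut = solve-∀
  distrib : ∀ f s → f ⊗ (s ⊕ + 1) ≡ f ⊕ f ⊗ s
  distrib = solve-∀
  pushIn : ∀ c p t w → (c ⊗ (p ⊗ w)) ⊗ t ≡ c ⊗ ((t ⊗ p) ⊗ w)
  pushIn = solve-∀

term-zero : ∀ ε n L π → π ∈ perms n → 2 ≤ n → term ε L 0 π ≡ - (inClassℤ ε π ⊗ (turnProduct L π ⊗ endSign π))
term-zero ε n L π π∈ 2≤n with ∈-perms⁻ n π π∈
... | isPerm refl _ u = begin
  c ⊗ (p ⊗ ((−1^ (pkval π + 1)) ⊗ + 1))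
    ≡⟨ cong (λ z → c ⊗ (p ⊗ (z ⊗ + 1))) (−1^-+ (pkval π) 1) ⟩
  c ⊗ (p ⊗ ((−1^ pkval π ⊗ - + 1) ⊗ + 1))
    ≡⟨ cong (λ z → c ⊗ (p ⊗ ((z ⊗ - + 1) ⊗ + 1))) (−1^pkval≡endSign π u 2≤n) ⟩
  c ⊗ (p ⊗ ((endSign π ⊗ - + 1) ⊗ + 1))
    ≡⟨ negateOut c p (endSign π) ⟩
  - (c ⊗ (p ⊗ endSign π)) ∎
  where
  open ≡-Reasoning
  c = inClassℤ ε π
  p = turnProduct L π
  negateOut : ∀ c p e → c ⊗ (p ⊗ ((e ⊗ - + 1) ⊗ + 1)) ≡ - (c ⊗ (p ⊗ e))
  negateOut = solve-∀

-- Induction on m, moving one factor of altruns into the product of turn indicators at each step.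
moment≡0 : ∀ ε n k → 2 ≤ n → (∀ L → length L ≤ k → endMoment ε n L ≡ + 0) →
  ∀ m L → length L + m ≤ k → moment ε n L m ≡ + 0
moment≡0 ε n k 2≤n vanishes zero L le =
  trans (∑-cong (perms n) (λ π π∈ → term-zero ε n L π π∈ 2≤n))
  (trans (∑-neg _ (perms n)) (cong -_ (vanishes L (subst (_≤ k) (ℕP.+-identityʳ _) le))))
moment≡0 ε n k 2≤n vanishes (suc m) L le =
  trans (∑-cong (perms n) (λ π π∈ → term-suc ε n L m π (IsPerm.len (∈-perms⁻ n π π∈))))
  (trans (∑-+ _ _ (perms n))
  (cong₂ _⊕_ (moment≡0 ε n k 2≤n vanishes m L (ℕP.≤-trans (ℕP.+-monoʳ-≤ (length L) (ℕP.n≤1+n m)) le))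
    (trans (∑-comm (λ π i → term ε (i ∷ L) m π) (perms n) (upTo (n ∸ 2)))
      (∑-zero _ (upTo (n ∸ 2)) (λ i _ → moment≡0 ε n k 2≤n vanishes m (i ∷ L)
          (subst (_≤ k) (ℕP.+-suc (length L) m) le))))))

sum≡∑ : {A : Set} (h : A → ℕ) (xs : List A) → + sum (map h xs) ≡ ∑ (λ x → + h x) xs
sum≡∑ h [] = refl
sum≡∑ h (x ∷ xs) = trans (ℤP.pos-+ (h x) _) (cong (+ h x ⊕_) (sum≡∑ h xs))

length-filter≡∑ : {A : Set} (b : A → Bool) (xs : List A) →
  + length (filter (λ x → T? (b x)) xs) ≡ ∑ (λ x → 𝟙ℤ (b x)) xs
length-filter≡∑ b [] = refl
length-filter≡∑ b (x ∷ xs) with b x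
... | true = trans (ℤP.pos-+ 1 _) (cong (+ 1 ⊕_) (length-filter≡∑ b xs))
... | false = trans (length-filter≡∑ b xs) (sym (ℤP.+-identityˡ _))

𝟙ℤ-∧ : ∀ a b → 𝟙ℤ (a ∧ b) ≡ 𝟙ℤ a ⊗ 𝟙ℤ b
𝟙ℤ-∧ true b = sym (ℤP.*-identityˡ _)
𝟙ℤ-∧ false b = refl

δ : ℕ → ℕ → ℤ
δ x y = 𝟙ℤ (x ≡ᵇ y)

∑-δ-outside : ∀ (g : ℕ → ℤ) N x → N ≤ x → ∑ (λ j → g j ⊗ δ x j) (upTo N) ≡ + 0
∑-δ-outside g N x N≤x = ∑-zero _ (upTo N) (λ j j∈ → vanish j (∈-upTo⁻ j∈))
  where
  vanish : ∀ j → j < N → g j ⊗ δ x j ≡ + 0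
  vanish j j<N rewrite ≢⇒≡ᵇ≡false {x} {j} (λ { refl → ℕP.<⇒≱ j<N N≤x }) = ℤP.*-zeroʳ (g j)

∑-δ : ∀ (g : ℕ → ℤ) N x → x < N → ∑ (λ j → g j ⊗ δ x j) (upTo N) ≡ g x
∑-δ g (suc N) x x<1+N =
  trans (cong (∑ (λ j → g j ⊗ δ x j)) (sym (LP.upTo-∷ʳ N)))
  (trans (∑-++ (λ j → g j ⊗ δ x j) (upTo N) [ N ]) (lastOrNot (ℕP.<-cmp x N)))
  where
  lastOrNot : _ → ∑ (λ j → g j ⊗ δ x j) (upTo N) ⊕ (g N ⊗ δ x N ⊕ + 0) ≡ g x
  lastOrNot (tri< x<N x≢N _) rewrite ∑-δ g N x x<N | ≢⇒≡ᵇ≡false x≢N =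
    trans (cong (g x ⊕_) (cong (_⊕ + 0) (ℤP.*-zeroʳ (g N)))) (ℤP.+-identityʳ _)
  lastOrNot (tri≈ _ refl _) rewrite ∑-δ-outside g x x ℕP.≤-refl | ≡⇒≡ᵇ≡true {x} refl =
    trans (ℤP.+-identityˡ _) (trans (ℤP.+-identityʳ _) (ℤP.*-identityʳ (g x)))
  lastOrNot (tri> _ _ N<x) = ⊥-elim (ℕP.<⇒≱ N<x (ℕP.≤-pred x<1+N))

R≡∑ : ∀ ε n j → + R ε n j ≡ ∑ (λ π → inClassℤ ε π ⊗ δ (altruns π) j) (perms n)
R≡∑ ε n j = trans (length-filter≡∑ (λ π → inClass ε π ∧ (altruns π ≡ᵇ j)) (perms n))
  (∑-cong (perms n) (λ π _ → 𝟙ℤ-∧ (inClass ε π) _))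

coef : ℕ → ℕ → ℤ
coef k j = - (−1^ j) ⊗ + (j ^ k)

oddTerm evenTerm : Bool → ℕ → ℕ → ℕ → ℕ
oddTerm ε n k j = if isEven j then 0 else j ^ k ℕ.* R ε n j
evenTerm ε n k j = if isEven j then j ^ k ℕ.* R ε n j else 0

oddTerm-evenTerm : ∀ ε n k j → + oddTerm ε n k j ⊕ - (+ evenTerm ε n k j) ≡ coef k j ⊗ + R ε n j
oddTerm-evenTerm ε n k j rewrite −1^-isEven j with isEven j
... | true = trans (cong (λ z → + 0 ⊕ - z) (ℤP.pos-* (j ^ k) _)) (evenCase (+ (j ^ k)) (+ R ε n j))
  where
  evenCase : ∀ a b → + 0 ⊕ - (a ⊗ b) ≡ (- (+ 1) ⊗ a) ⊗ b
  evenCase = solve-∀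
... | false = trans (cong (λ z → z ⊕ - (+ 0)) (ℤP.pos-* (j ^ k) _)) (oddCase (+ (j ^ k)) (+ R ε n j))
  where
  oddCase : ∀ a b → a ⊗ b ⊕ - (+ 0) ≡ (- (- (+ 1)) ⊗ a) ⊗ b
  oddCase = solve-∀

oddSum-evenSum≡∑coef : ∀ ε n k →
  + oddSum ε n k ℤ.- + evenSum ε n k ≡ ∑ (λ j → coef k j ⊗ + R ε n j) (map suc (upTo n))
oddSum-evenSum≡∑coef ε n k =
  trans (cong₂ (λ x y → x ⊕ - y) (sum≡∑ (oddTerm ε n k) J) (sum≡∑ (evenTerm ε n k) J))
  (trans (cong (∑ (λ j → + oddTerm ε n k j) J ⊕_) (sym (∑-neg _ J)))
  (trans (sym (∑-+ _ _ J)) (∑-cong J (λ j _ → oddTerm-evenTerm ε n k j))))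
  where
  J = map suc (upTo n)

∑coef-δ≡-term : ∀ ε n k π → π ∈ perms n → 2 ≤ n →
  ∑ (λ j → coef k j ⊗ (inClassℤ ε π ⊗ δ (altruns π) j)) (map suc (upTo n)) ≡ - term ε [] k π
∑coef-δ≡-term ε n k π π∈ 2≤n = begin
  ∑ (λ j → coef k j ⊗ (c ⊗ δ A j)) (map suc (upTo n))
    ≡⟨ ∑-map _ suc (upTo n) ⟩
  ∑ (λ j → coef k (suc j) ⊗ (c ⊗ δ A (suc j))) (upTo n)
    ≡⟨ ∑-cong (upTo n) (λ j _ → shiftIndex j) ⟩
  ∑ (λ j → c ⊗ (coef k (suc j) ⊗ δ (pkval π) j)) (upTo n)
    ≡⟨ ∑-*ˡ c _ (upTo n) ⟩
  c ⊗ ∑ (λ j → coef k (suc j) ⊗ δ (pkval π) j) (upTo n)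
    ≡⟨ cong (c ⊗_) (∑-δ (λ j → coef k (suc j)) n (pkval π) pkval<n) ⟩
  c ⊗ coef k (suc (pkval π))
    ≡⟨ cong (λ z → c ⊗ coef k z) (ℕP.+-comm 1 (pkval π)) ⟩
  c ⊗ (- (−1^ A) ⊗ + (A ^ k))
    ≡⟨ negateOut c (−1^ A) (+ (A ^ k)) ⟩
  - term ε [] k π ∎
  where
  open ≡-Reasoning
  A = altruns π
  c = inClassℤ ε π
  swapFactors : ∀ a c d → a ⊗ (c ⊗ d) ≡ c ⊗ (a ⊗ d)
  swapFactors = solve-∀
  shiftIndex : ∀ j → coef k (suc j) ⊗ (c ⊗ δ A (suc j)) ≡ c ⊗ (coef k (suc j) ⊗ δ (pkval π) j)
  shiftIndex j = trans (swapFactors (coef k (suc j)) c _)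
    (cong (λ z → c ⊗ (coef k (suc j) ⊗ 𝟙ℤ (z ≡ᵇ suc j))) (ℕP.+-comm (pkval π) 1))
  negateOut : ∀ c s p → c ⊗ (- s ⊗ p) ≡ - (c ⊗ (+ 1 ⊗ (s ⊗ p)))
  negateOut = solve-∀
  pkval<length : ∀ σ → 1 ≤ length σ → pkval σ < length σ
  pkval<length (a ∷ σ) _ = s≤s (pkval≤length a σ)
  pkval<n : pkval π < n
  pkval<n with ∈-perms⁻ n π π∈
  ... | isPerm refl _ _ = pkval<length π (ℕP.≤-trans (s≤s z≤n) 2≤n)

oddSum≡evenSum-if-moment≡0 : ∀ ε n k → 2 ≤ n → moment ε n [] k ≡ + 0 → oddSum ε n k ≡ evenSum ε n k
oddSum≡evenSum-if-moment≡0 ε n k 2≤n moment≡0 = ℤP.+-injective (ℤP.i-j≡0⇒i≡j _ _ (begin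
  + oddSum ε n k ℤ.- + evenSum ε n k
    ≡⟨ oddSum-evenSum≡∑coef ε n k ⟩
  ∑ (λ j → coef k j ⊗ + R ε n j) J
    ≡⟨ ∑-cong J (λ j _ → trans (cong (coef k j ⊗_) (R≡∑ ε n j)) (sym (∑-*ˡ (coef k j) _ (perms n)))) ⟩
  ∑ (λ j → ∑ (λ π → summand j π) (perms n)) J
    ≡⟨ ∑-comm summand J (perms n) ⟩
  ∑ (λ π → ∑ (λ j → summand j π) J) (perms n)
    ≡⟨ ∑-cong (perms n) (λ π π∈ → ∑coef-δ≡-term ε n k π π∈ 2≤n) ⟩
  ∑ (λ π → - term ε [] k π) (perms n)
    ≡⟨ ∑-neg _ (perms n) ⟩
  - moment ε n [] k
    ≡⟨ cong -_ moment≡0 ⟩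
  + 0 ∎))
  where
  open ≡-Reasoning
  J = map suc (upTo n)
  summand : ℕ → List ℕ → ℤ
  summand j π = coef k j ⊗ (inClassℤ ε π ⊗ δ (altruns π) j)

private
  ∈-delete : ∀ {x y : ℕ} as bs → y ∈ as ++ x ∷ bs → y ≢ x → y ∈ as ++ bs
  ∈-delete as bs y∈ y≢x with ∈-++⁻ as y∈
  ... | inj₁ p = ∈-++⁺ˡ p
  ... | inj₂ (here e) = ⊥-elim (y≢x e)
  ... | inj₂ (there p) = ∈-++⁺ʳ as p

  length-delete : ∀ {x : ℕ} as bs → length (as ++ x ∷ bs) ≡ suc (length (as ++ bs))
  length-delete as bs =
    trans (LP.length-++ as) (trans (ℕP.+-suc (length as) (length bs)) (cong suc (sym (LP.length-++ as))))

Unique-⊆⇒length≤ : ∀ (xs ys : List ℕ) → Unique xs → (∀ x → x ∈ xs → x ∈ ys) → length xs ≤ length ys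
Unique-⊆⇒length≤ [] ys u sub = z≤n
Unique-⊆⇒length≤ (x ∷ xs) ys (x∉ ∷ u) sub with ∈-∃++ (sub x (here refl))
... | as , bs , refl = subst (suc (length xs) ≤_) (sym (length-delete as bs))
  (s≤s (Unique-⊆⇒length≤ xs (as ++ bs) u
    (λ z z∈ → ∈-delete as bs (sub z (there z∈)) (λ e → All.lookup x∉ z∈ (sym e)))))

Unique-⊂⇒length< : ∀ (xs ys : List ℕ) y → Unique xs → (∀ x → x ∈ xs → x ∈ ys) → y ∈ ys → y ∉ xs →
  length xs < length ys
Unique-⊂⇒length< [] (_ ∷ _) y u sub y∈ y∉ = s≤s z≤n
Unique-⊂⇒length< (x ∷ xs) ys y (x∉ ∷ u) sub y∈ y∉ with ∈-∃++ (sub x (here refl))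
... | as , bs , refl = subst (suc (length xs) <_) (sym (length-delete as bs))
  (s≤s (Unique-⊂⇒length< xs (as ++ bs) y u
    (λ z z∈ → ∈-delete as bs (sub z (there z∈)) (λ e → All.lookup x∉ z∈ (sym e)))
    (∈-delete as bs y∈ (λ e → y∉ (here e))) (λ p → y∉ (there p))))

IsPerm⇒∈ : ∀ {n π} → IsPerm n π → ∀ x → x < n → x ∈ π
IsPerm⇒∈ {n} {π} (isPerm l b u) x x<n with x ∈? π
... | yes x∈ = x∈
... | no x∉ = ⊥-elim (ℕP.<-irrefl (trans l (sym (LP.length-upTo n)))
    (Unique-⊂⇒length< π (upTo n) x u (λ y y∈ → ∈-upTo⁺ (All.lookup b y∈)) (∈-upTo⁺ x<n) x∉))

Unique-resp-↭ : ∀ {xs ys : List ℕ} → xs ↭ ys → Unique xs → Unique ys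
Unique-resp-↭ ↭-refl u = u
Unique-resp-↭ (prep x p) (x∉ ∷ u) = ↭P.All-resp-↭ p x∉ ∷ Unique-resp-↭ p u
Unique-resp-↭ (swap x y p) ((x≢y ∷ x∉) ∷ y∉ ∷ u) =
  ((λ e → x≢y (sym e)) ∷ ↭P.All-resp-↭ p y∉) ∷ ↭P.All-resp-↭ p x∉ ∷ Unique-resp-↭ p u
Unique-resp-↭ (↭-trans p q) u = Unique-resp-↭ q (Unique-resp-↭ p u)

IsPerm-resp-↭ : ∀ {n xs ys} → xs ↭ ys → IsPerm n xs → IsPerm n ys
IsPerm-resp-↭ p (isPerm l b u) =
  isPerm (trans (sym (↭P.↭-length p)) l) (↭P.All-resp-↭ p b) (Unique-resp-↭ p u)

turnAt-++ˡ : ∀ xs ys i → suc (suc i) < length xs → turnAt (xs ++ ys) i ≡ turnAt xs i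
turnAt-++ˡ (a ∷ b ∷ c ∷ r) ys zero _ = refl
turnAt-++ˡ (a ∷ r) ys (suc i) (s≤s h) = turnAt-++ˡ r ys i h
turnAt-++ˡ (a ∷ b ∷ []) ys zero (s≤s (s≤s ()))

turnAt-++ʳ : ∀ xs ys i → turnAt (xs ++ ys) (length xs + i) ≡ turnAt ys i
turnAt-++ʳ [] ys i = refl
turnAt-++ʳ (a ∷ xs) ys i = turnAt-++ʳ xs ys i

lastAscent-++ : ∀ xs ys → 2 ≤ length ys → lastAscent (xs ++ ys) ≡ lastAscent ys
lastAscent-++ [] ys h = refl
lastAscent-++ (a ∷ []) (b ∷ c ∷ ys) h = refl
lastAscent-++ (a ∷ a′ ∷ []) (c ∷ d ∷ ys) h = lastAscent-++ (a′ ∷ []) (c ∷ d ∷ ys) h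
lastAscent-++ (a ∷ a′ ∷ x ∷ xs) ys h = lastAscent-++ (a′ ∷ x ∷ xs) ys h
lastAscent-++ (_ ∷ []) (_ ∷ []) (s≤s ())
lastAscent-++ (_ ∷ _ ∷ []) (_ ∷ []) (s≤s ())

turnAt-map-reversing : ∀ (f : ℕ → ℕ) (P : ℕ → Set) → (∀ x y → P x → P y → (f x <ᵇ f y) ≡ (y <ᵇ x)) →
  ∀ xs → All P xs → ∀ i → turnAt (map f xs) i ≡ turnAt xs i
turnAt-map-reversing f P rev (a ∷ b ∷ c ∷ r) (pa ∷ pb ∷ pc ∷ _) zero
  rewrite rev a b pa pb | rev c b pc pb | rev b a pb pa | rev b c pb pc =
  cong 𝟙 (BP.∨-comm ((b <ᵇ a) ∧ (b <ᵇ c)) _)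
turnAt-map-reversing f P rev (a ∷ r) (_ ∷ ps) (suc i) = turnAt-map-reversing f P rev r ps i
turnAt-map-reversing f P rev [] _ i = refl
turnAt-map-reversing f P rev (a ∷ []) _ zero = refl
turnAt-map-reversing f P rev (a ∷ b ∷ []) _ zero = refl

𝟙-mono : ∀ {a b} → (T a → T b) → 𝟙 a ≤ 𝟙 b
𝟙-mono {false} h = z≤n
𝟙-mono {true} {true} h = s≤s z≤n
𝟙-mono {true} {false} h = ⊥-elim (h tt)

private
  <ᵇ-mono : ∀ {b x y} → x < y → T (b <ᵇ x) → T (b <ᵇ y)
  <ᵇ-mono {b} {x} x<y p = ℕP.<⇒<ᵇ (ℕP.<-trans (ℕP.<ᵇ⇒< b x p) x<y)

countLess-mono : ∀ {x y} → x < y → ∀ V → countLess x V ≤ countLess y V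
countLess-mono x<y [] = z≤n
countLess-mono {x} {y} x<y (b ∷ V) =
  ℕP.+-mono-≤ (𝟙-mono {b <ᵇ x} (<ᵇ-mono x<y)) (countLess-mono x<y V)

countLess-strict : ∀ {x y} → x < y → ∀ V → x ∈ V → countLess x V < countLess y V
countLess-strict {x} {y} x<y (b ∷ V) (here refl) rewrite n<ᵇn≡false x | <⇒<ᵇ≡true x<y =
  s≤s (countLess-mono x<y V)
countLess-strict {x} {y} x<y (b ∷ V) (there x∈) =
  ℕP.+-mono-≤-< (𝟙-mono {b <ᵇ x} (<ᵇ-mono x<y)) (countLess-strict x<y V x∈)

countLess≤length : ∀ v V → countLess v V ≤ length V
countLess≤length v [] = z≤n
countLess≤length v (b ∷ V) = ℕP.+-mono-≤ (𝟙-mono {b <ᵇ v} (λ _ → tt)) (countLess≤length v V)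

countLess<length : ∀ v V → v ∈ V → countLess v V < length V
countLess<length v (b ∷ V) (here refl) rewrite n<ᵇn≡false v = s≤s (countLess≤length v V)
countLess<length v (b ∷ V) (there v∈) =
  ℕP.+-mono-≤-< (𝟙-mono {b <ᵇ v} (λ _ → tt)) (countLess<length v V v∈)

countLess-injectiveOn : ∀ V x y → x ∈ V → y ∈ V → countLess x V ≡ countLess y V → x ≡ y
countLess-injectiveOn V x y x∈ y∈ e with ℕP.<-cmp x y
... | tri< x<y _ _ = ⊥-elim (ℕP.<-irrefl e (countLess-strict x<y V x∈))
... | tri≈ _ x≡y _ = x≡y
... | tri> _ _ y<x = ⊥-elim (ℕP.<-irrefl (sym e) (countLess-strict y<x V y∈))

countLess-reflects-< : ∀ V u w → w ∈ V → countLess u V < countLess w V → u < w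
countLess-reflects-< V u w w∈ lt with ℕP.<-cmp u w
... | tri< u<w _ _ = u<w
... | tri≈ _ refl _ = ⊥-elim (ℕP.<-irrefl refl lt)
... | tri> _ _ w<u = ⊥-elim (ℕP.<-asym lt (countLess-strict w<u V w∈))

countLess-resp-↭ : ∀ v {V V′} → V ↭ V′ → countLess v V ≡ countLess v V′
countLess-resp-↭ v ↭-refl = refl
countLess-resp-↭ v (prep x p) = cong (𝟙 (x <ᵇ v) ℕ.+_) (countLess-resp-↭ v p)
countLess-resp-↭ v (swap x y p) =
  trans (sym (ℕP.+-assoc (𝟙 (x <ᵇ v)) (𝟙 (y <ᵇ v)) _))
  (trans (cong₂ _+_ (ℕP.+-comm (𝟙 (x <ᵇ v)) (𝟙 (y <ᵇ v))) (countLess-resp-↭ v p)) (ℕP.+-assoc (𝟙 (y <ᵇ v)) _ _))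
countLess-resp-↭ v (↭-trans p q) = trans (countLess-resp-↭ v p) (countLess-resp-↭ v q)

countLess-surjective : ∀ V → Unique V → ∀ r → r < length V → ∃ λ u → u ∈ V × countLess u V ≡ r
countLess-surjective (a ∷ V) (a∉ ∷ u) r r< with ℕP.<-cmp r (countLess a V)
... | tri≈ _ refl _ = a , here refl , cong (λ b → 𝟙 b + countLess a V) (n<ᵇn≡false a)
... | tri< r<rank _ _ with countLess-surjective V u r (ℕP.<-≤-trans r<rank (countLess≤length a V))
...   | w , w∈ , refl = w , there w∈ , cong (_+ countLess w V) (cong 𝟙 (≮⇒<ᵇ≡false a≮w))
  where
  a≮w : ¬ a < w
  a≮w a<w = ℕP.<⇒≱ r<rank (countLess-mono a<w V)
countLess-surjective (a ∷ V) (a∉ ∷ u) (suc r) r< | tri> _ _ rank<r with countLess-surjective V u r (ℕP.≤-pred r<)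
... | w , w∈ , refl = w , there w∈ , cong (_+ countLess w V) (cong 𝟙 (<⇒<ᵇ≡true a<w))
  where
  a<w : a < w
  a<w with ℕP.<-cmp a w
  ... | tri< a<w _ _ = a<w
  ... | tri≈ _ a≡w _ = ⊥-elim (All.lookup a∉ w∈ a≡w)
  ... | tri> _ _ w<a = ⊥-elim (ℕP.<⇒≱ rank<r (countLess-strict w<a V w∈))

firstSatisfying : (ℕ → Bool) → List ℕ → ℕ
firstSatisfying p [] = 0
firstSatisfying p (x ∷ xs) = if p x then x else firstSatisfying p xs

firstSatisfying-spec : ∀ p xs u → u ∈ xs → T (p u) →
  firstSatisfying p xs ∈ xs × T (p (firstSatisfying p xs))
firstSatisfying-spec p (x ∷ xs) u u∈ pu with p x in eq
... | true = here refl , subst T (sym eq) tt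
firstSatisfying-spec p (x ∷ xs) u (here refl) pu | false = ⊥-elim (subst T eq pu)
firstSatisfying-spec p (x ∷ xs) u (there u∈) pu | false with firstSatisfying-spec p xs u u∈ pu
... | first∈ , satisfies = there first∈ , satisfies

complementIn : List ℕ → ℕ → ℕ
complementIn V v = firstSatisfying (λ u → countLess u V ≡ᵇ (length V ∸ 1 ∸ countLess v V)) V

module _ (V : List ℕ) (u : Unique V) where
  private
    M = length V ∸ 1

    rank≤M : ∀ v → v ∈ V → countLess v V ≤ M
    rank≤M v v∈ = <⇒≤∸1 (countLess<length v V v∈)
      where
      <⇒≤∸1 : ∀ {r l} → r < l → r ≤ l ∸ 1
      <⇒≤∸1 (s≤s r≤l) = r≤l

    M∸rank<length : ∀ v → v ∈ V → M ∸ countLess v V < length V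
    M∸rank<length v v∈ =
      ℕP.≤-<-trans (ℕP.m∸n≤m M (countLess v V)) (∸1< (countLess<length v V v∈))
      where
      ∸1< : ∀ {r l} → r < l → l ∸ 1 < l
      ∸1< {l = suc l} _ = ℕP.n<1+n l

    complementIn-spec : ∀ v → v ∈ V → complementIn V v ∈ V × countLess (complementIn V v) V ≡ M ∸ countLess v V
    complementIn-spec v v∈ with countLess-surjective V u (M ∸ countLess v V) (M∸rank<length v v∈)
    ... | w , w∈ , e with firstSatisfying-spec (λ u → countLess u V ≡ᵇ (M ∸ countLess v V)) V w w∈ (ℕP.≡⇒≡ᵇ _ _ e)
    ... | c∈ , c-rank = c∈ , ℕP.≡ᵇ⇒≡ _ _ c-rank

  complementIn-∈ : ∀ v → v ∈ V → complementIn V v ∈ V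
  complementIn-∈ v v∈ = proj₁ (complementIn-spec v v∈)

  complementIn-rank : ∀ v → v ∈ V → countLess (complementIn V v) V ≡ M ∸ countLess v V
  complementIn-rank v v∈ = proj₂ (complementIn-spec v v∈)

  complementIn-involutive : ∀ v → v ∈ V → complementIn V (complementIn V v) ≡ v
  complementIn-involutive v v∈ = countLess-injectiveOn V _ v (complementIn-∈ _ (complementIn-∈ v v∈)) v∈
    (trans (complementIn-rank _ (complementIn-∈ v v∈))
    (trans (cong (M ∸_) (complementIn-rank v v∈)) (ℕP.m∸[m∸n]≡n (rank≤M v v∈))))

  complementIn-reversing : ∀ x y → x ∈ V → y ∈ V → (complementIn V x <ᵇ complementIn V y) ≡ (y <ᵇ x)
  complementIn-reversing x y x∈ y∈ with ℕP.<-cmp y x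
  ... | tri< y<x _ _ rewrite <⇒<ᵇ≡true y<x = <⇒<ᵇ≡true
        (countLess-reflects-< V _ _ (complementIn-∈ y y∈)
          (subst₂ _<_ (sym (complementIn-rank x x∈)) (sym (complementIn-rank y y∈))
            (ℕP.∸-monoʳ-< (countLess-strict y<x V y∈) (rank≤M x x∈))))
  ... | tri≈ _ refl _ rewrite n<ᵇn≡false y = n<ᵇn≡false (complementIn V y)
  ... | tri> y≮x _ x<y rewrite ≮⇒<ᵇ≡false y≮x = ≮⇒<ᵇ≡false (λ lt → ℕP.<⇒≱
        (countLess-strict lt V (complementIn-∈ x x∈))
        (subst₂ _≤_ (sym (complementIn-rank y y∈)) (sym (complementIn-rank x x∈))
          (ℕP.∸-monoʳ-≤ M (countLess-mono x<y V))))

complementIn-resp-↭ : ∀ V V′ → Unique V → V ↭ V′ → ∀ v → v ∈ V → complementIn V′ v ≡ complementIn V v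
complementIn-resp-↭ V V′ u p v v∈ =
  countLess-injectiveOn V _ _ c′∈ (complementIn-∈ V u v v∈)
    (trans (countLess-resp-↭ _ p) (trans (complementIn-rank V′ u′ v v∈′)
      (sym (trans (complementIn-rank V u v v∈) (cong₂ (λ a b → a ∸ 1 ∸ b) (↭P.↭-length p) (countLess-resp-↭ v p))))))
  where
  u′ : Unique V′
  u′ = Unique-resp-↭ p u
  v∈′ : v ∈ V′
  v∈′ = ↭P.∈-resp-↭ p v∈
  c′∈ : complementIn V′ v ∈ V
  c′∈ = ↭P.∈-resp-↭ (↭-sym p) (complementIn-∈ V′ u′ v v∈′)

-- Complementing a prefix: the sum over all of 𝔖ₙ vanishes

take-length-++ : ∀ (xs ys : List ℕ) → take (length xs) (xs ++ ys) ≡ xs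
take-length-++ [] ys = refl
take-length-++ (x ∷ xs) ys = cong (x ∷_) (take-length-++ xs ys)

drop-length-++ : ∀ (xs ys : List ℕ) → drop (length xs) (xs ++ ys) ≡ ys
drop-length-++ [] ys = refl
drop-length-++ (x ∷ xs) ys = drop-length-++ xs ys

complementPrefix : ℕ → List ℕ → List ℕ
complementPrefix j π = map (complementIn (take (suc j) π)) (take (suc j) π) ++ drop (suc j) π

module ComplementPrefix (j : ℕ) (π : List ℕ) (u : Unique π) (j<length : suc j ≤ length π) where
  P = take (suc j) π
  S = drop (suc j) π
  X = map (complementIn P) P

  unique-P : Unique P
  unique-P = UniqueP.take⁺ (suc j) u

  X↭P : X ↭ P
  X↭P = map-involution-↭ (complementIn P) P unique-P (complementIn-∈ P unique-P) (complementIn-involutive P unique-P)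

  P++S≡π : P ++ S ≡ π
  P++S≡π = LP.take++drop≡id (suc j) π

  length-P : length P ≡ suc j
  length-P = trans (LP.length-take (suc j) π) (ℕP.m≤n⇒m⊓n≡m j<length)

  length-X : length X ≡ suc j
  length-X = trans (LP.length-map (complementIn P) P) length-P

  complementPrefix-↭ : complementPrefix j π ↭ π
  complementPrefix-↭ = subst (complementPrefix j π ↭_) P++S≡π (↭P.++⁺ʳ S X↭P)

  complementPrefix-involutive : complementPrefix j (complementPrefix j π) ≡ π
  complementPrefix-involutive =
    trans (cong₂ (λ A B → map (complementIn A) A ++ B) takeX dropX)
    (trans (cong (_++ S) (trans (sym (LP.map-∘ P)) (LP.map-id-local (All.tabulate twice))))
    P++S≡π)
    where
    takeX : take (suc j) (X ++ S) ≡ X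
    takeX = subst (λ m → take m (X ++ S) ≡ X) length-X (take-length-++ X S)
    dropX : drop (suc j) (X ++ S) ≡ S
    dropX = subst (λ m → drop m (X ++ S) ≡ S) length-X (drop-length-++ X S)
    twice : ∀ {v} → v ∈ P → complementIn X (complementIn P v) ≡ v
    twice {v} v∈ = trans (complementIn-resp-↭ P X unique-P (↭-sym X↭P) _ (complementIn-∈ P unique-P v v∈))
                         (complementIn-involutive P unique-P v v∈)

  turnAt-complementPrefix : ∀ ℓ → ℓ ≢ j → suc ℓ ≢ j → turnAt (complementPrefix j π) ℓ ≡ turnAt π ℓ
  turnAt-complementPrefix ℓ ℓ≢j 1+ℓ≢j with ℕP.<-cmp ℓ j
  ... | tri< ℓ<j _ _ = begin
    turnAt (X ++ S) ℓ
      ≡⟨ turnAt-++ˡ X S ℓ (subst (suc (suc ℓ) <_) (sym length-X) window<j) ⟩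
    turnAt X ℓ
      ≡⟨ turnAt-map-reversing (complementIn P) (_∈ P) (complementIn-reversing P unique-P) P (All.tabulate (λ x → x)) ℓ ⟩
    turnAt P ℓ
      ≡⟨ sym (turnAt-++ˡ P S ℓ (subst (suc (suc ℓ) <_) (sym length-P) window<j)) ⟩
    turnAt (P ++ S) ℓ
      ≡⟨ cong (λ σ → turnAt σ ℓ) P++S≡π ⟩
    turnAt π ℓ ∎
    where
    open ≡-Reasoning
    window<j : suc (suc ℓ) < suc j
    window<j = s≤s (ℕP.≤∧≢⇒< ℓ<j 1+ℓ≢j)
  ... | tri≈ _ ℓ≡j _ = ⊥-elim (ℓ≢j ℓ≡j)
  ... | tri> _ _ j<ℓ = begin
    turnAt (X ++ S) ℓ
      ≡⟨ cong (turnAt (X ++ S)) (ℓ≡ {X} length-X) ⟩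
    turnAt (X ++ S) (length X + i)
      ≡⟨ turnAt-++ʳ X S i ⟩
    turnAt S i
      ≡⟨ sym (turnAt-++ʳ P S i) ⟩
    turnAt (P ++ S) (length P + i)
      ≡⟨ cong (turnAt (P ++ S)) (sym (ℓ≡ {P} length-P)) ⟩
    turnAt (P ++ S) ℓ
      ≡⟨ cong (λ σ → turnAt σ ℓ) P++S≡π ⟩
    turnAt π ℓ ∎
    where
    open ≡-Reasoning
    i = ℓ ∸ suc j
    ℓ≡ : ∀ {Y : List ℕ} → length Y ≡ suc j → ℓ ≡ length Y + i
    ℓ≡ eq = trans (sym (ℕP.m+[n∸m]≡n j<ℓ)) (cong (_+ i) (sym eq))

avoids : ℕ → ℕ → Set
avoids j ℓ = ℓ ≢ j × suc ℓ ≢ j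

turnProduct-complementPrefix : ∀ j π (u : Unique π) (j< : suc j ≤ length π) L → All (avoids j) L →
  turnProduct L (complementPrefix j π) ≡ turnProduct L π
turnProduct-complementPrefix j π u j< [] [] = refl
turnProduct-complementPrefix j π u j< (ℓ ∷ L) ((ℓ≢j , 1+ℓ≢j) ∷ avs) =
  cong₂ (λ a b → + a ⊗ b) (ComplementPrefix.turnAt-complementPrefix j π u j< ℓ ℓ≢j 1+ℓ≢j)
    (turnProduct-complementPrefix j π u j< L avs)

-- With 1 ≤ j and j + 3 ≤ length π the first step is reversed while the last two values are untouched.
endSign-complementPrefix : ∀ j π → Unique π → 1 ≤ j → suc (suc (suc j)) ≤ length π →
  endSign (complementPrefix j π) ≡ - endSign π
endSign-complementPrefix (suc j′) (a ∷ []) _ _ (s≤s ())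
endSign-complementPrefix (suc j′) (a ∷ b ∷ r) u@((a≢b ∷ _) ∷ _) _ j+3≤ =
  trans (cong₂ (λ x y → sign x ⊗ sign y) firstFlips lastKept)
  (trans (cong (_⊗ sign (lastAscent (a ∷ b ∷ r))) (sign-not (a <ᵇ b)))
    (sym (ℤP.neg-distribˡ-* (sign (a <ᵇ b)) _)))
  where
  j = suc j′
  open ComplementPrefix j (a ∷ b ∷ r) u (ℕP.≤-trans (ℕP.n≤1+n _) (ℕP.≤-trans (ℕP.n≤1+n _) j+3≤))
  firstFlips : firstAscent (complementPrefix j (a ∷ b ∷ r)) ≡ not (a <ᵇ b)
  firstFlips = trans (complementIn-reversing P unique-P a b (here refl) (there (here refl))) (<ᵇ-flip a b a≢b)
  length-S : 2 ≤ length S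
  length-S = subst (2 ≤_) (sym (LP.length-drop (suc j) (a ∷ b ∷ r))) (ℕP.m+n≤o⇒m≤o∸n 2 j+3≤)
  lastKept : lastAscent (complementPrefix j (a ∷ b ∷ r)) ≡ lastAscent (a ∷ b ∷ r)
  lastKept = trans (lastAscent-++ X S length-S) (trans (sym (lastAscent-++ P S length-S)) (cong lastAscent P++S≡π))

∑turnProduct⊗endSign≡0-if-avoids : ∀ n L j → 1 ≤ j → suc (suc (suc j)) ≤ n → All (avoids j) L →
  ∑ (λ π → turnProduct L π ⊗ endSign π) (perms n) ≡ + 0
∑turnProduct⊗endSign≡0-if-avoids n L j 1≤j j+3≤n avs =
  ∑-signReversing≡0 (complementPrefix j) (perms n) (perms-unique n) closed involutive _ reverses
  where
  module _ (π : List ℕ) (π∈ : π ∈ perms n) where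
    isPermπ = ∈-perms⁻ n π π∈
    u = IsPerm.unq isPermπ
    j+3≤length : suc (suc (suc j)) ≤ length π
    j+3≤length = subst (_ ≤_) (sym (IsPerm.len isPermπ)) j+3≤n
    j<length : suc j ≤ length π
    j<length = ℕP.≤-trans (ℕP.n≤1+n _) (ℕP.≤-trans (ℕP.n≤1+n _) j+3≤length)
    closed : complementPrefix j π ∈ perms n
    closed = ∈-perms⁺ n _ (IsPerm-resp-↭ (↭-sym (ComplementPrefix.complementPrefix-↭ j π u j<length)) isPermπ)
    involutive : complementPrefix j (complementPrefix j π) ≡ π
    involutive = ComplementPrefix.complementPrefix-involutive j π u j<length
    reverses : turnProduct L (complementPrefix j π) ⊗ endSign (complementPrefix j π) ≡ - (turnProduct L π ⊗ endSign π)
    reverses = trans (cong₂ _⊗_ (turnProduct-complementPrefix j π u j<length L avs)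
                                 (endSign-complementPrefix j π u 1≤j j+3≤length))
                     (sym (ℤP.neg-distribʳ-* (turnProduct L π) _))

double : ℕ → ℕ
double zero = 0
double (suc m) = suc (suc (double m))

⌊double/2⌋≡ : ∀ m → ⌊ double m /2⌋ ≡ m
⌊double/2⌋≡ zero = refl
⌊double/2⌋≡ (suc m) = cong suc (⌊double/2⌋≡ m)

⌊1+double/2⌋≡ : ∀ m → ⌊ suc (double m) /2⌋ ≡ m
⌊1+double/2⌋≡ zero = refl
⌊1+double/2⌋≡ (suc m) = cong suc (⌊1+double/2⌋≡ m)

double≡2* : ∀ m → double m ≡ 2 * m
double≡2* zero = refl
double≡2* (suc m) = trans (cong (λ z → suc (suc z)) (double≡2* m)) (cong suc (sym (ℕP.+-suc m (m + 0))))

double-mono : ∀ {a b} → a ≤ b → double a ≤ double b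
double-mono z≤n = z≤n
double-mono (s≤s h) = s≤s (s≤s (double-mono h))

∃∉upTo : ∀ k (M : List ℕ) → length M ≤ k → ∃ λ r → r < suc k × r ∉ M
∃∉upTo k M length≤k with All.all? (_∈? M) (upTo (suc k))
... | yes allIn = ⊥-elim (ℕP.<⇒≱ (s≤s length≤k)
      (subst (_≤ length M) (LP.length-upTo (suc k))
        (Unique-⊆⇒length≤ (upTo (suc k)) M (UniqueP.upTo⁺ (suc k)) (λ x x∈ → All.lookup allIn x∈))))
... | no notAllIn with find (AllP.¬All⇒Any¬ (_∈? M) (upTo (suc k)) notAllIn)
...   | r , r∈ , r∉ = r , ∈-upTo⁻ r∈ , r∉

-- Among the k + 1 odd positions 1, 3, …, 2k + 1 one is avoided by all ℓ ∈ L, since ℓ can only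
-- spoil the odd position 2⌊ℓ/2⌋ + 1.
∃oddAvoided : ∀ n k L → length L ≤ k → 2 * k + 4 ≤ n →
  ∃ λ j → 1 ≤ j × suc (suc (suc j)) ≤ n × All (avoids j) L
∃oddAvoided n k L length≤k 2k+4≤n with ∃∉upTo k (map ⌊_/2⌋ L) (subst (_≤ k) (sym (LP.length-map ⌊_/2⌋ L)) length≤k)
... | r , r≤k , r∉ = suc (double r) , s≤s z≤n , fits , All.tabulate avoided
  where
  fits : suc (suc (suc (suc (double r)))) ≤ n
  fits = ℕP.≤-trans (subst (_≤ 2 * k + 4) (ℕP.+-comm (double r) 4)
           (subst (λ z → double r + 4 ≤ z + 4) (double≡2* k) (ℕP.+-monoˡ-≤ 4 (double-mono (ℕP.≤-pred r≤k))))) 2k+4≤n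
  avoided : ∀ {ℓ} → ℓ ∈ L → avoids (suc (double r)) ℓ
  avoided {ℓ} ℓ∈ =
      (λ e → r∉ (subst (_∈ map ⌊_/2⌋ L) (trans (cong ⌊_/2⌋ e) (⌊1+double/2⌋≡ r)) (∈-map⁺ ⌊_/2⌋ ℓ∈)))
    , (λ e → r∉ (subst (_∈ map ⌊_/2⌋ L) (trans (cong ⌊_/2⌋ (ℕP.suc-injective e)) (⌊double/2⌋≡ r)) (∈-map⁺ ⌊_/2⌋ ℓ∈)))

∑turnProduct⊗endSign≡0 : ∀ n k L → length L ≤ k → 2 * k + 4 ≤ n →
  ∑ (λ π → turnProduct L π ⊗ endSign π) (perms n) ≡ + 0
∑turnProduct⊗endSign≡0 n k L length≤k 2k+4≤n with ∃oddAvoided n k L length≤k 2k+4≤n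
... | j , 1≤j , j+3≤n , avs = ∑turnProduct⊗endSign≡0-if-avoids n L j 1≤j j+3≤n avs

even : ℕ → Bool
even zero = true
even (suc m) = not (even m)

isEven≡even : ∀ m → isEven m ≡ even m
isEven≡even zero = refl
isEven≡even (suc zero) = refl
isEven≡even (suc (suc m)) = trans
  (cong (λ r → r ℕ.≡ᵇ 0) (trans (cong (_% 2) (ℕP.+-comm 2 m)) ([m+n]%n≡m%n m 2)))
  (trans (isEven≡even m) (sym (BP.not-involutive (even m))))

_≐_ : Bool → Bool → Bool
true ≐ b = b
false ≐ b = not b

even-+ : ∀ a b → even (a + b) ≡ (even a ≐ even b)
even-+ zero b = refl
even-+ (suc a) b rewrite even-+ a b with even a
... | true = refl
... | false = BP.not-involutive _

≐≡false⇒≡not : ∀ a b → (a ≐ b) ≡ false → a ≡ not b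
≐≡false⇒≡not true false _ = refl
≐≡false⇒≡not false true _ = refl

inClassℤ-flip : ∀ ε π π′ → isEven (inv π′) ≡ not (isEven (inv π)) → inClassℤ ε π′ ≡ inClassℤ (not ε) π
inClassℤ-flip true π π′ e = cong 𝟙ℤ e
inClassℤ-flip false π π′ e = cong 𝟙ℤ (trans (cong not e) (BP.not-involutive _))

endMoment-flip : ∀ ε n L (φ : List ℕ → List ℕ) →
  (∀ π → π ∈ perms n → φ π ∈ perms n) → (∀ π → π ∈ perms n → φ (φ π) ≡ π) →
  (∀ π → π ∈ perms n → turnProduct L (φ π) ⊗ endSign (φ π) ≡ turnProduct L π ⊗ endSign π) →
  (∀ π → π ∈ perms n → isEven (inv (φ π)) ≡ not (isEven (inv π))) →
  endMoment ε n L ≡ endMoment (not ε) n L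
endMoment-flip ε n L φ closed involutive weight-invariant parity-flips =
  trans (∑-involution φ (perms n) (perms-unique n) closed involutive _)
  (∑-cong (perms n) (λ π π∈ → cong₂ _⊗_ (inClassℤ-flip ε π (φ π) (parity-flips π π∈)) (weight-invariant π π∈)))

-- Complementing all values, for n ≡ 2, 3 (mod 4)

triangle : ℕ → ℕ
triangle zero = 0
triangle (suc l) = l + triangle l

even-triangle-+4 : ∀ x → even (triangle (suc (suc (suc (suc x))))) ≡ even (triangle x)
even-triangle-+4 x rewrite even-+ (suc (suc (suc x))) (suc (suc x) + (suc x + (x + triangle x)))
  | even-+ (suc (suc x)) (suc x + (x + triangle x)) | even-+ (suc x) (x + triangle x) | even-+ x (triangle x)
  with even x | even (triangle x)
... | true | true = refl
... | true | false = refl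
... | false | true = refl
... | false | false = refl

even-triangle-mod4 : ∀ r q → even (triangle (r + q * 4)) ≡ even (triangle r)
even-triangle-mod4 r zero = cong (λ z → even (triangle z)) (ℕP.+-identityʳ r)
even-triangle-mod4 r (suc q) =
  trans (cong (λ z → even (triangle z)) r+4q+4≡) (trans (even-triangle-+4 (r + q * 4)) (even-triangle-mod4 r q))
  where
  r+4q+4≡ : r + suc q * 4 ≡ suc (suc (suc (suc (r + q * 4))))
  r+4q+4≡ = trans (cong (r ℕ.+_) (ℕP.+-comm 4 (q * 4))) (trans (sym (ℕP.+-assoc r (q * 4) 4)) (ℕP.+-comm _ 4))

triangle-odd : ∀ n → (n % 4 ≡ 2 ⊎ n % 4 ≡ 3) → even (triangle n) ≡ false
triangle-odd n n%4 = trans (cong (λ z → even (triangle z)) (m≡m%n+[m/n]*n n 4))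
  (trans (even-triangle-mod4 (n % 4) (n / 4)) (small n%4))
  where
  small : (n % 4 ≡ 2 ⊎ n % 4 ≡ 3) → even (triangle (n % 4)) ≡ false
  small (inj₁ e) rewrite e = refl
  small (inj₂ e) rewrite e = refl

module Reflection (m : ℕ) where
  n = suc m

  reflect : ℕ → ℕ
  reflect x = m ∸ x

  reflect-reversing : ∀ x y → x ≤ m → y ≤ m → (reflect x <ᵇ reflect y) ≡ (y <ᵇ x)
  reflect-reversing x y x≤ y≤ with ℕP.<-cmp y x
  ... | tri< y<x _ _ rewrite <⇒<ᵇ≡true y<x = <⇒<ᵇ≡true (ℕP.∸-monoʳ-< y<x x≤)
  ... | tri≈ _ refl _ rewrite n<ᵇn≡false y = n<ᵇn≡false (reflect y)
  ... | tri> y≮x _ x<y rewrite ≮⇒<ᵇ≡false y≮x =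
        ≮⇒<ᵇ≡false (λ lt → ℕP.<⇒≱ lt (ℕP.∸-monoʳ-≤ m (ℕP.<⇒≤ x<y)))

  reflectAll : List ℕ → List ℕ
  reflectAll = map reflect

  reflectAll-IsPerm : ∀ π → IsPerm n π → IsPerm n (reflectAll π)
  reflectAll-IsPerm π (isPerm l b u) = isPerm (trans (LP.length-map reflect π) l) (bounded π b)
    (Unique-map⁺-injectiveOn reflect π u
      (λ x y x∈ y∈ e → ℕP.∸-cancelˡ-≡ (ℕP.≤-pred (All.lookup b x∈)) (ℕP.≤-pred (All.lookup b y∈)) e))
    where
    bounded : ∀ xs → All (_< n) xs → All (_< n) (map reflect xs)
    bounded [] [] = []
    bounded (x ∷ xs) (p ∷ ps) = s≤s (ℕP.m∸n≤m m x) ∷ bounded xs ps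

  reflectAll-involutive : ∀ π → All (_< n) π → reflectAll (reflectAll π) ≡ π
  reflectAll-involutive [] [] = refl
  reflectAll-involutive (x ∷ π) (p ∷ ps) = cong₂ _∷_ (ℕP.m∸[m∸n]≡n (ℕP.≤-pred p)) (reflectAll-involutive π ps)

  ascent-reflect : ∀ a b → a < n → b < n → a ≢ b → (reflect a <ᵇ reflect b) ≡ not (a <ᵇ b)
  ascent-reflect a b a<n b<n a≢b = trans (reflect-reversing a b (ℕP.≤-pred a<n) (ℕP.≤-pred b<n)) (<ᵇ-flip a b a≢b)

  lastAscent-reflectAll : ∀ π → All (_< n) π → Unique π → 2 ≤ length π → lastAscent (reflectAll π) ≡ not (lastAscent π)
  lastAscent-reflectAll (a ∷ b ∷ []) (pa ∷ pb ∷ _) ((a≢b ∷ _) ∷ _) _ = ascent-reflect a b pa pb a≢b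
  lastAscent-reflectAll (a ∷ b ∷ d ∷ r) (_ ∷ ps) (_ ∷ u) _ = lastAscent-reflectAll (b ∷ d ∷ r) ps u (s≤s (s≤s z≤n))
  lastAscent-reflectAll (a ∷ []) _ _ (s≤s ())

  endSign-reflectAll : ∀ π → All (_< n) π → Unique π → 2 ≤ length π → endSign (reflectAll π) ≡ endSign π
  endSign-reflectAll π@(a ∷ b ∷ r) ps@(pa ∷ pb ∷ _) u@((a≢b ∷ _) ∷ _) 2≤ =
    trans (cong₂ (λ x y → sign x ⊗ sign y) (ascent-reflect a b pa pb a≢b) (lastAscent-reflectAll π ps u 2≤))
    (trans (cong₂ _⊗_ (sign-not (a <ᵇ b)) (sign-not (lastAscent π))) (neg⊗neg (sign (a <ᵇ b)) _))
    where
    neg⊗neg : ∀ x y → (- x) ⊗ (- y) ≡ x ⊗ y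
    neg⊗neg = solve-∀
  endSign-reflectAll (a ∷ []) _ _ (s≤s ())

  private
    +-interchange : ∀ a b p q → (a + b) + (p + q) ≡ (a + p) + (b + q)
    +-interchange = ℕ-solve-∀

  turnProduct-reflectAll : ∀ L π → All (_< n) π → turnProduct L (reflectAll π) ≡ turnProduct L π
  turnProduct-reflectAll [] π _ = refl
  turnProduct-reflectAll (ℓ ∷ L) π ps =
    cong₂ (λ a b → + a ⊗ b) (turnAt-map-reversing reflect (_≤ m) reflect-reversing π (All.map ℕP.≤-pred ps) ℓ)
      (turnProduct-reflectAll L π ps)

  -- Each b ≠ a is counted exactly once: either b < a or reflect b < reflect a.
  countLess-reflect : ∀ a as → a ≤ m → All (_< n) as → All (a ≢_) as →
    countLess (reflect a) (reflectAll as) + countLess a as ≡ length as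
  countLess-reflect a [] _ _ _ = refl
  countLess-reflect a (b ∷ as) a≤m (b<n ∷ ps) (a≢b ∷ qs) rewrite reflect-reversing b a (ℕP.≤-pred b<n) a≤m =
    trans (sym (+-interchange (𝟙 (a <ᵇ b)) (𝟙 (b <ᵇ a)) (countLess (reflect a) (reflectAll as)) (countLess a as)))
      (trans (cong (λ z → 𝟙 (a <ᵇ b) + 𝟙 (b <ᵇ a) + z) (countLess-reflect a as a≤m ps qs)) exactlyOne)
    where
    exactlyOne : 𝟙 (a <ᵇ b) + 𝟙 (b <ᵇ a) + length as ≡ suc (length as)
    exactlyOne rewrite <ᵇ-flip a b a≢b with a <ᵇ b
    ... | true = refl
    ... | false = refl

  inv-reflectAll : ∀ π → All (_< n) π → Unique π → inv (reflectAll π) + inv π ≡ triangle (length π)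
  inv-reflectAll [] _ _ = refl
  inv-reflectAll (a ∷ as) (pa ∷ ps) (a∉ ∷ u) =
    trans (+-interchange (countLess (reflect a) (reflectAll as)) (inv (reflectAll as)) (countLess a as) (inv as))
    (cong₂ _+_ (countLess-reflect a as (ℕP.≤-pred pa) ps a∉) (inv-reflectAll as ps u))

  endMoment-reflectAll : ∀ ε L → 2 ≤ n → even (triangle n) ≡ false → endMoment ε n L ≡ endMoment (not ε) n L
  endMoment-reflectAll ε L 2≤n triangle-odd = endMoment-flip ε n L reflectAll closed involutive weight parity
    where
    module _ (π : List ℕ) (π∈ : π ∈ perms n) where
      isPermπ = ∈-perms⁻ n π π∈
      closed : reflectAll π ∈ perms n
      closed = ∈-perms⁺ n _ (reflectAll-IsPerm π isPermπ)
      involutive : reflectAll (reflectAll π) ≡ π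
      involutive = reflectAll-involutive π (IsPerm.bnd isPermπ)
      weight : turnProduct L (reflectAll π) ⊗ endSign (reflectAll π) ≡ turnProduct L π ⊗ endSign π
      weight = cong₂ _⊗_ (turnProduct-reflectAll L π (IsPerm.bnd isPermπ))
        (endSign-reflectAll π (IsPerm.bnd isPermπ) (IsPerm.unq isPermπ) (subst (2 ≤_) (sym (IsPerm.len isPermπ)) 2≤n))
      parity : isEven (inv (reflectAll π)) ≡ not (isEven (inv π))
      parity = trans (isEven≡even (inv (reflectAll π)))
        (trans (≐≡false⇒≡not (even (inv (reflectAll π))) (even (inv π))
          (trans (sym (even-+ (inv (reflectAll π)) (inv π)))
          (trans (cong even (inv-reflectAll π (IsPerm.bnd isPermπ) (IsPerm.unq isPermπ)))
          (trans (cong (λ z → even (triangle z)) (IsPerm.len isPermπ)) triangle-odd))))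
        (cong not (sym (isEven≡even (inv π)))))

-- Transposing the values 2m and 2m + 1, for n ≡ 0, 1 (mod 4)

double-injective : ∀ {a b} → double a ≡ double b → a ≡ b
double-injective {a} {b} e = trans (sym (⌊double/2⌋≡ a)) (trans (cong ⌊_/2⌋ e) (⌊double/2⌋≡ b))

1+double≢double : ∀ a b → suc (double a) ≢ double b
1+double≢double a b e with trans (sym (⌊1+double/2⌋≡ a)) (trans (cong ⌊_/2⌋ e) (⌊double/2⌋≡ b))
... | refl = ℕP.1+n≢n e

<ᵇ-skipʳ : ∀ v y → y ≢ v → y ≢ suc v → (suc v <ᵇ y) ≡ (v <ᵇ y)
<ᵇ-skipʳ v y y≢v y≢1+v with ℕP.<-cmp v y
... | tri< v<y _ _ = trans (<⇒<ᵇ≡true (ℕP.≤∧≢⇒< v<y (λ e → y≢1+v (sym e)))) (sym (<⇒<ᵇ≡true v<y))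
... | tri≈ _ e _ = ⊥-elim (y≢v (sym e))
... | tri> v≮y _ _ = trans (≮⇒<ᵇ≡false (λ lt → v≮y (ℕP.<-trans (ℕP.n<1+n v) lt))) (sym (≮⇒<ᵇ≡false v≮y))

<ᵇ-skipˡ : ∀ v x → x ≢ v → x ≢ suc v → (x <ᵇ suc v) ≡ (x <ᵇ v)
<ᵇ-skipˡ v x x≢v x≢1+v with ℕP.<-cmp x v
... | tri< x<v _ _ = trans (<⇒<ᵇ≡true (ℕP.<-trans x<v (ℕP.n<1+n v))) (sym (<⇒<ᵇ≡true x<v))
... | tri≈ _ e _ = ⊥-elim (x≢v e)
... | tri> x≮v _ v<x = trans (≮⇒<ᵇ≡false (λ lt → ℕP.<⇒≱ v<x (ℕP.≤-pred lt))) (sym (≮⇒<ᵇ≡false x≮v))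

transpose : ℕ → ℕ → ℕ
transpose m x = if x ≡ᵇ double m then suc (double m) else (if x ≡ᵇ suc (double m) then double m else x)

data PairView (m x : ℕ) : Set where
  low : x ≡ double m → PairView m x
  high : x ≡ suc (double m) → PairView m x
  other : x ≢ double m → x ≢ suc (double m) → PairView m x

pairView : ∀ m x → PairView m x
pairView m x with x ℕP.≟ double m | x ℕP.≟ suc (double m)
... | yes e | _ = low e
... | no _ | yes e = high e
... | no x≢v | no x≢w = other x≢v x≢w

transpose-low : ∀ m → transpose m (double m) ≡ suc (double m)
transpose-low m rewrite ≡⇒≡ᵇ≡true {double m} refl = refl

transpose-high : ∀ m → transpose m (suc (double m)) ≡ double m
transpose-high m rewrite ≢⇒≡ᵇ≡false {suc (double m)} {double m} ℕP.1+n≢n | ≡⇒≡ᵇ≡true {suc (double m)} refl = refl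

transpose-other : ∀ m x → x ≢ double m → x ≢ suc (double m) → transpose m x ≡ x
transpose-other m x x≢v x≢w rewrite ≢⇒≡ᵇ≡false x≢v | ≢⇒≡ᵇ≡false x≢w = refl

transpose-involutive : ∀ m x → transpose m (transpose m x) ≡ x
transpose-involutive m x with pairView m x
... | low refl rewrite transpose-low m = transpose-high m
... | high refl rewrite transpose-high m = transpose-low m
... | other x≢v x≢w rewrite transpose-other m x x≢v x≢w = transpose-other m x x≢v x≢w

transpose-< : ∀ n m x → suc (double m) < n → x < n → transpose m x < n
transpose-< n m x w<n x<n with pairView m x
... | low refl rewrite transpose-low m = w<n
... | high refl rewrite transpose-high m = ℕP.<-trans (ℕP.n<1+n _) w<n
... | other x≢v x≢w rewrite transpose-other m x x≢v x≢w = x<n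

map-transpose-involutive : ∀ m π → map (transpose m) (map (transpose m) π) ≡ π
map-transpose-involutive m π = trans (sym (LP.map-∘ π)) (LP.map-id-local (All.tabulate (λ {x} _ → transpose-involutive m x)))

map-transpose-IsPerm : ∀ n m π → suc (double m) < n → IsPerm n π → IsPerm n (map (transpose m) π)
map-transpose-IsPerm n m π w<n (isPerm l b u) =
  isPerm (trans (LP.length-map (transpose m) π) l)
    (AllP.map⁺ (All.map (transpose-< n m _ w<n) b))
    (Unique-map⁺-injectiveOn (transpose m) π u
      (λ x y _ _ e → trans (sym (transpose-involutive m x)) (trans (cong (transpose m) e) (transpose-involutive m y))))

isPair : ℕ → ℕ → ℕ → Bool
isPair v x y = ((x ≡ᵇ v) ∧ (y ≡ᵇ suc v)) ∨ ((x ≡ᵇ suc v) ∧ (y ≡ᵇ v))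

isPair-low-high : ∀ v → T (isPair v v (suc v))
isPair-low-high v rewrite ≡⇒≡ᵇ≡true {v} refl = tt

isPair-high-low : ∀ v → T (isPair v (suc v) v)
isPair-high-low v rewrite ≡⇒≡ᵇ≡true {v} refl = subst T (sym (BP.∨-zeroʳ _)) tt

isPair-sym : ∀ v x y → isPair v x y ≡ isPair v y x
isPair-sym v x y = trans (BP.∨-comm ((x ≡ᵇ v) ∧ (y ≡ᵇ suc v)) _)
  (cong₂ _∨_ (BP.∧-comm (x ≡ᵇ suc v) (y ≡ᵇ v)) (BP.∧-comm (x ≡ᵇ v) (y ≡ᵇ suc v)))

isPair⇒⌊/2⌋ : ∀ m x y → T (isPair (double m) x y) → ⌊ x /2⌋ ≡ m × ⌊ y /2⌋ ≡ m
isPair⇒⌊/2⌋ m x y p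
  with x ≡ᵇ double m in e₁ | y ≡ᵇ suc (double m) in e₂ | x ≡ᵇ suc (double m) in e₃ | y ≡ᵇ double m in e₄
... | true | true | _ | _ = trans (cong ⌊_/2⌋ (≡ᵇ≡true⇒≡ {x} e₁)) (⌊double/2⌋≡ m)
                          , trans (cong ⌊_/2⌋ (≡ᵇ≡true⇒≡ {y} e₂)) (⌊1+double/2⌋≡ m)
... | false | _ | true | true = trans (cong ⌊_/2⌋ (≡ᵇ≡true⇒≡ {x} e₃)) (⌊1+double/2⌋≡ m)
                              , trans (cong ⌊_/2⌋ (≡ᵇ≡true⇒≡ {y} e₄)) (⌊double/2⌋≡ m)
... | true | false | true | _ =
  ⊥-elim (1+double≢double m m (trans (sym (≡ᵇ≡true⇒≡ {x} e₃)) (≡ᵇ≡true⇒≡ {x} e₁)))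

transpose-<ᵇ : ∀ m x y → ¬ T (isPair (double m) x y) → (transpose m x <ᵇ transpose m y) ≡ (x <ᵇ y)
transpose-<ᵇ m x y notPair with pairView m x | pairView m y
... | low refl | low refl = trans (n<ᵇn≡false (transpose m (double m))) (sym (n<ᵇn≡false (double m)))
... | low refl | high refl = ⊥-elim (notPair (isPair-low-high (double m)))
... | low refl | other y≢v y≢w rewrite transpose-low m | transpose-other m y y≢v y≢w = <ᵇ-skipʳ (double m) y y≢v y≢w
... | high refl | low refl = ⊥-elim (notPair (isPair-high-low (double m)))
... | high refl | high refl = trans (n<ᵇn≡false (transpose m (suc (double m)))) (sym (n<ᵇn≡false (suc (double m))))
... | high refl | other y≢v y≢w rewrite transpose-high m | transpose-other m y y≢v y≢w = sym (<ᵇ-skipʳ (double m) y y≢v y≢w)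
... | other x≢v x≢w | low refl rewrite transpose-low m | transpose-other m x x≢v x≢w = <ᵇ-skipˡ (double m) x x≢v x≢w
... | other x≢v x≢w | high refl rewrite transpose-high m | transpose-other m x x≢v x≢w = sym (<ᵇ-skipˡ (double m) x x≢v x≢w)
... | other x≢v x≢w | other y≢v y≢w rewrite transpose-other m x x≢v x≢w | transpose-other m y y≢v y≢w = refl

transpose-≡ᵇ : ∀ m x z → (transpose m x ≡ᵇ z) ≡ (x ≡ᵇ transpose m z)
transpose-≡ᵇ m x z with x ≡ᵇ transpose m z in e
... | true = ≡⇒≡ᵇ≡true {transpose m x} {z} (trans (cong (transpose m) (≡ᵇ≡true⇒≡ {x} e)) (transpose-involutive m z))
... | false = ≢⇒≡ᵇ≡false {transpose m x} {z} (λ tx≡z → ⊥-elim (subst T e (ℕP.≡⇒≡ᵇ x (transpose m z)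
    (trans (sym (transpose-involutive m x)) (cong (transpose m) tx≡z)))))

transpose-otherPair : ∀ m m′ → m ≢ m′ →
  transpose m (double m′) ≡ double m′ × transpose m (suc (double m′)) ≡ suc (double m′)
transpose-otherPair m m′ m≢m′ =
    transpose-other m (double m′) (λ e → m≢m′ (sym (double-injective e))) (λ e → 1+double≢double m m′ (sym e))
  , transpose-other m (suc (double m′)) (1+double≢double m′ m) (λ e → m≢m′ (sym (double-injective (ℕP.suc-injective e))))

isPair-transpose : ∀ m m′ x y → isPair (double m′) (transpose m x) (transpose m y) ≡ isPair (double m′) x y
isPair-transpose m m′ x y
  rewrite transpose-≡ᵇ m x (double m′) | transpose-≡ᵇ m y (suc (double m′))
        | transpose-≡ᵇ m x (suc (double m′)) | transpose-≡ᵇ m y (double m′)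
  with m ℕP.≟ m′
... | yes refl rewrite transpose-low m | transpose-high m = BP.∨-comm ((x ≡ᵇ suc (double m)) ∧ (y ≡ᵇ double m)) _
... | no m≢m′ rewrite proj₁ (transpose-otherPair m m′ m≢m′) | proj₂ (transpose-otherPair m m′ m≢m′) = refl

pairOnlyAt : (ℕ → Bool) → ℕ → List ℕ → ℕ → Bool
pairOnlyAt free v (a ∷ b ∷ r) q = (not (isPair v a b) ∨ free q) ∧ pairOnlyAt free v (b ∷ r) (suc q)
pairOnlyAt free v _ q = true

pairOnlyAt-transpose : ∀ free m m′ π q →
  pairOnlyAt free (double m′) (map (transpose m) π) q ≡ pairOnlyAt free (double m′) π q
pairOnlyAt-transpose free m m′ [] q = refl
pairOnlyAt-transpose free m m′ (a ∷ []) q = refl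
pairOnlyAt-transpose free m m′ (a ∷ b ∷ r) q =
  cong₂ (λ p z → (not p ∨ free q) ∧ z) (isPair-transpose m m′ a b) (pairOnlyAt-transpose free m m′ (b ∷ r) (suc q))

firstGoodPair : (ℕ → Bool) → List ℕ → ℕ → ℕ → Maybe ℕ
firstGoodPair free π m₀ zero = nothing
firstGoodPair free π m₀ (suc K) =
  if pairOnlyAt free (double m₀) π 0 then just m₀ else firstGoodPair free π (suc m₀) K

firstGoodPair-transpose : ∀ free m π m₀ K → firstGoodPair free (map (transpose m) π) m₀ K ≡ firstGoodPair free π m₀ K
firstGoodPair-transpose free m π m₀ zero = refl
firstGoodPair-transpose free m π m₀ (suc K) rewrite pairOnlyAt-transpose free m m₀ π 0 =
  cong (if pairOnlyAt free (double m₀) π 0 then just m₀ else_) (firstGoodPair-transpose free m π (suc m₀) K)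

firstGoodPair-just : ∀ free π m₀ K m → firstGoodPair free π m₀ K ≡ just m →
  T (pairOnlyAt free (double m) π 0) × m < m₀ + K
firstGoodPair-just free π m₀ (suc K) m e with pairOnlyAt free (double m₀) π 0 in good
... | true with e
...   | refl = subst T (sym good) tt , ℕP.m<m+n m₀ (s≤s z≤n)
firstGoodPair-just free π m₀ (suc K) m e | false with firstGoodPair-just free π (suc m₀) K m e
... | isGood , m< = isGood , subst (m <_) (sym (ℕP.+-suc m₀ K)) m<

firstGoodPair-nothing : ∀ free π m₀ K → firstGoodPair free π m₀ K ≡ nothing →
  ∀ i → i < K → pairOnlyAt free (double (m₀ + i)) π 0 ≡ false
firstGoodPair-nothing free π m₀ (suc K) e i i< with pairOnlyAt free (double m₀) π 0 in good
firstGoodPair-nothing free π m₀ (suc K) () i i< | true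
firstGoodPair-nothing free π m₀ (suc K) e zero i< | false =
  trans (cong (λ z → pairOnlyAt free (double z) π 0) (ℕP.+-identityʳ m₀)) good
firstGoodPair-nothing free π m₀ (suc K) e (suc i) i< | false =
  trans (cong (λ z → pairOnlyAt free (double z) π 0) (ℕP.+-suc m₀ i))
    (firstGoodPair-nothing free π (suc m₀) K e i (ℕP.≤-pred i<))

isTurn-cong : ∀ {a b c a′ b′ c′} → (a′ <ᵇ b′) ≡ (a <ᵇ b) → (c′ <ᵇ b′) ≡ (c <ᵇ b) →
  (b′ <ᵇ a′) ≡ (b <ᵇ a) → (b′ <ᵇ c′) ≡ (b <ᵇ c) → isTurn a′ b′ c′ ≡ isTurn a b c
isTurn-cong e₁ e₂ e₃ e₄ rewrite e₁ | e₂ | e₃ | e₄ = refl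

module TransposeLocally (free : ℕ → Bool) (m : ℕ) where
  v = double m

  turnAt-transpose : ∀ π q i → T (pairOnlyAt free v π q) → ¬ T (free (q + i)) → ¬ T (free (suc (q + i))) →
    turnAt (map (transpose m) π) i ≡ turnAt π i
  turnAt-transpose (a ∷ b ∷ c ∷ r) q zero good fixed₁ fixed₂ =
    cong 𝟙 (isTurn-cong {a} {b} {c} {transpose m a} {transpose m b} {transpose m c}
             (transpose-<ᵇ m a b ab) (transpose-<ᵇ m c b cb) (transpose-<ᵇ m b a ba) (transpose-<ᵇ m b c bc))
    where
    ab : ¬ T (isPair v a b)
    ab = T-not∨⁻ (T-∧ˡ good) (subst (λ z → ¬ T (free z)) (ℕP.+-identityʳ q) fixed₁)
    bc : ¬ T (isPair v b c)
    bc = T-not∨⁻ (T-∧ˡ (T-∧ʳ {not (isPair v a b) ∨ free q} good))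
                 (subst (λ z → ¬ T (free (suc z))) (ℕP.+-identityʳ q) fixed₂)
    ba : ¬ T (isPair v b a)
    ba p = ab (subst T (isPair-sym v b a) p)
    cb : ¬ T (isPair v c b)
    cb p = bc (subst T (isPair-sym v c b) p)
  turnAt-transpose (a ∷ b ∷ r) q (suc i) good fixed₁ fixed₂ =
    turnAt-transpose (b ∷ r) (suc q) i (T-∧ʳ {not (isPair v a b) ∨ free q} good)
      (subst (λ z → ¬ T (free z)) (ℕP.+-suc q i) fixed₁) (subst (λ z → ¬ T (free (suc z))) (ℕP.+-suc q i) fixed₂)
  turnAt-transpose [] q i _ _ _ = refl
  turnAt-transpose (a ∷ []) q zero _ _ _ = refl
  turnAt-transpose (a ∷ []) q (suc i) _ _ _ = refl
  turnAt-transpose (a ∷ b ∷ []) q zero _ _ _ = refl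

  firstAscent-transpose : ∀ a b r → T (pairOnlyAt free v (a ∷ b ∷ r) 0) → ¬ T (free 0) →
    firstAscent (map (transpose m) (a ∷ b ∷ r)) ≡ firstAscent (a ∷ b ∷ r)
  firstAscent-transpose a b r good fixed = transpose-<ᵇ m a b (T-not∨⁻ (T-∧ˡ good) fixed)

  lastAscent-transpose : ∀ π q → 2 ≤ length π → T (pairOnlyAt free v π q) → ¬ T (free (q + (length π ∸ 2))) →
    lastAscent (map (transpose m) π) ≡ lastAscent π
  lastAscent-transpose (a ∷ b ∷ []) q _ good fixed =
    transpose-<ᵇ m a b (T-not∨⁻ (T-∧ˡ good) (subst (λ z → ¬ T (free z)) (ℕP.+-identityʳ q) fixed))
  lastAscent-transpose (a ∷ b ∷ c ∷ r) q _ good fixed =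
    lastAscent-transpose (b ∷ c ∷ r) (suc q) (s≤s (s≤s z≤n)) (T-∧ʳ {not (isPair v a b) ∨ free q} good)
      (subst (λ z → ¬ T (free z)) (ℕP.+-suc q (length r)) fixed)
  lastAscent-transpose (a ∷ []) q (s≤s ()) _ _

  turnProduct-transpose : ∀ L π → (∀ ℓ → ℓ ∈ L → ¬ T (free ℓ) × ¬ T (free (suc ℓ))) → T (pairOnlyAt free v π 0) →
    turnProduct L (map (transpose m) π) ≡ turnProduct L π
  turnProduct-transpose [] π _ _ = refl
  turnProduct-transpose (ℓ ∷ L) π fixed good = cong₂ (λ a b → + a ⊗ b)
    (turnAt-transpose π 0 ℓ good (proj₁ (fixed ℓ (here refl))) (proj₂ (fixed ℓ (here refl))))
    (turnProduct-transpose L π (λ ℓ′ ℓ′∈ → fixed ℓ′ (there ℓ′∈)) good)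

unreserved : List ℕ → ℕ → Bool
unreserved [] q = true
unreserved (ℓ ∷ R) q = (not (ℓ ≡ᵇ q) ∧ not (suc ℓ ≡ᵇ q)) ∧ unreserved R q

unreserved-∈ : ∀ R ℓ → ℓ ∈ R → ¬ T (unreserved R ℓ) × ¬ T (unreserved R (suc ℓ))
unreserved-∈ (x ∷ R) ℓ (here refl) =
    (λ p → subst T (cong not (≡⇒≡ᵇ≡true {x} refl)) (T-∧ˡ (T-∧ˡ p)))
  , (λ p → subst T (cong not (≡⇒≡ᵇ≡true {suc x} refl)) (T-∧ʳ {not (x ≡ᵇ suc x)} (T-∧ˡ p)))
unreserved-∈ (x ∷ R) ℓ (there ℓ∈) =
    (λ p → proj₁ (unreserved-∈ R ℓ ℓ∈) (T-∧ʳ {not (x ≡ᵇ ℓ) ∧ not (suc x ≡ᵇ ℓ)} p))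
  , (λ p → proj₂ (unreserved-∈ R ℓ ℓ∈) (T-∧ʳ {not (x ≡ᵇ suc ℓ) ∧ not (suc x ≡ᵇ suc ℓ)} p))

reserved⇒∃ : ∀ R q → ¬ T (unreserved R q) → ∃ λ ℓ → ℓ ∈ R × T ((q ≡ᵇ ℓ) ∨ (q ≡ᵇ suc ℓ))
reserved⇒∃ [] q h = ⊥-elim (h tt)
reserved⇒∃ (x ∷ R) q h with x ≡ᵇ q in e₁ | suc x ≡ᵇ q in e₂
... | true | _ = x , here refl , T-∨⁺ˡ (ℕP.≡⇒≡ᵇ q x (sym (≡ᵇ≡true⇒≡ {x} e₁)))
... | false | true = x , here refl , T-∨⁺ʳ {q ≡ᵇ x} (ℕP.≡⇒≡ᵇ q (suc x) (sym (≡ᵇ≡true⇒≡ {suc x} e₂)))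
... | false | false with reserved⇒∃ R q h
...   | ℓ , ℓ∈ , p = ℓ , there ℓ∈ , p

at : List ℕ → ℕ → ℕ
at [] _ = 0
at (x ∷ xs) zero = x
at (x ∷ xs) (suc i) = at xs i

firstBadPosition : (ℕ → Bool) → ℕ → List ℕ → ℕ → ℕ
firstBadPosition free v (a ∷ b ∷ r) q =
  if not (isPair v a b) ∨ free q then firstBadPosition free v (b ∷ r) (suc q) else q
firstBadPosition free v _ q = q

BadPositionSpec : (ℕ → Bool) → ℕ → List ℕ → ℕ → Set
BadPositionSpec free v π q = ∃ λ i →
  firstBadPosition free v π q ≡ q + i × T (isPair v (at π i) (at π (suc i))) × ¬ T (free (q + i))

not∨≡false : ∀ p f → (not p ∨ f) ≡ false → T p × ¬ T f
not∨≡false true false _ = tt , λ ()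

firstBadPosition-spec : ∀ free v π q → pairOnlyAt free v π q ≡ false → BadPositionSpec free v π q
firstBadPosition-spec free v (a ∷ b ∷ r) q notGood = step (firstBadPosition-spec free v (b ∷ r) (suc q))
  where
  step : (pairOnlyAt free v (b ∷ r) (suc q) ≡ false → BadPositionSpec free v (b ∷ r) (suc q)) →
    BadPositionSpec free v (a ∷ b ∷ r) q
  step rest with not (isPair v a b) ∨ free q in stepOk
  ... | false with not∨≡false (isPair v a b) (free q) stepOk
  ...   | isPairHere , notFree =
          0 , sym (ℕP.+-identityʳ q) , isPairHere , subst (λ z → ¬ T (free z)) (sym (ℕP.+-identityʳ q)) notFree
  step rest | true with rest notGood
  ... | i , pos≡ , isPairThere , notFree =
        suc i , trans pos≡ (sym (ℕP.+-suc q i)) , isPairThere , subst (λ z → ¬ T (free z)) (sym (ℕP.+-suc q i)) notFree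

memberᵇ : ℕ → List ℕ → Bool
memberᵇ x [] = false
memberᵇ x (y ∷ ys) = (x ≡ᵇ y) ∨ memberᵇ x ys

∈⇒memberᵇ : ∀ x ys → x ∈ ys → memberᵇ x ys ≡ true
∈⇒memberᵇ x (y ∷ ys) (here refl) rewrite ≡⇒≡ᵇ≡true {x} refl = refl
∈⇒memberᵇ x (y ∷ ys) (there p) rewrite ∈⇒memberᵇ x ys p = BP.∨-zeroʳ _

∉⇒memberᵇ : ∀ x ys → All (x ≢_) ys → memberᵇ x ys ≡ false
∉⇒memberᵇ x [] [] = refl
∉⇒memberᵇ x (y ∷ ys) (p ∷ ps) rewrite ≢⇒≡ᵇ≡false p = ∉⇒memberᵇ x ys ps

≐-assoc : ∀ a b x → (a ≐ (b ≐ x)) ≡ ((a ≐ b) ≐ x)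
≐-assoc true b x = refl
≐-assoc false true x = refl
≐-assoc false false x = BP.not-involutive x

≐-identityʳ : ∀ x → (x ≐ true) ≡ x
≐-identityʳ true = refl
≐-identityʳ false = refl

≐-not : ∀ x → (x ≐ false) ≡ not x
≐-not true = refl
≐-not false = refl

≐-swapʳ : ∀ a b c → ((a ≐ b) ≐ c) ≡ ((a ≐ c) ≐ b)
≐-swapʳ true true true = refl
≐-swapʳ true true false = refl
≐-swapʳ true false true = refl
≐-swapʳ true false false = refl
≐-swapʳ false true true = refl
≐-swapʳ false true false = refl
≐-swapʳ false false true = refl
≐-swapʳ false false false = refl

≐-cancelʳ : ∀ x y → ((x ≐ y) ≐ y) ≡ x
≐-cancelʳ true true = refl
≐-cancelʳ true false = refl
≐-cancelʳ false true = refl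
≐-cancelʳ false false = refl

even-𝟙 : ∀ b → even (𝟙 b) ≡ not b
even-𝟙 true = refl
even-𝟙 false = refl

module TranspositionParity (m : ℕ) where
  v = double m
  w = suc (double m)
  s = transpose m

  notPair-other : ∀ a b → a ≢ v → a ≢ w → ¬ T (isPair v b a)
  notPair-other a b a≢v a≢w p
    rewrite ≢⇒≡ᵇ≡false a≢v | ≢⇒≡ᵇ≡false a≢w | BP.∧-zeroʳ (b ≡ᵇ v) | BP.∧-zeroʳ (b ≡ᵇ w) = p

  countLess-other : ∀ a as → a ≢ v → a ≢ w → countLess (s a) (map s as) ≡ countLess a as
  countLess-other a [] _ _ = refl
  countLess-other a (b ∷ as) a≢v a≢w =
    cong₂ _+_ (cong 𝟙 (transpose-<ᵇ m b a (notPair-other a b a≢v a≢w)))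
      (countLess-other a as a≢v a≢w)

  countLess-low : ∀ as → Unique as → All (v ≢_) as → countLess w (map s as) ≡ countLess v as + 𝟙 (memberᵇ w as)
  countLess-low [] _ _ = refl
  countLess-low (b ∷ as) (b∉ ∷ u) (v≢b ∷ vs) with pairView m b
  ... | low e = ⊥-elim (v≢b (sym e))
  ... | high refl rewrite transpose-high m | ∉⇒memberᵇ w as b∉ | countLess-low as u vs | ∉⇒memberᵇ w as b∉
        | <⇒<ᵇ≡true (ℕP.n<1+n v) | ≮⇒<ᵇ≡false {w} {v} (ℕP.<-asym (ℕP.n<1+n v))
        | ≡⇒≡ᵇ≡true {w} refl = trans (ℕP.+-comm 1 _) (cong (_+ 1) (ℕP.+-identityʳ _))
  ... | other b≢v b≢w rewrite transpose-other m b b≢v b≢w | <ᵇ-skipˡ v b b≢v b≢w | countLess-low as u vs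
        | ≢⇒≡ᵇ≡false {w} {b} (λ e → b≢w (sym e)) = sym (ℕP.+-assoc (𝟙 (b <ᵇ v)) _ _)

  countLess-high : ∀ as → Unique as → All (w ≢_) as → countLess v (map s as) + 𝟙 (memberᵇ v as) ≡ countLess w as
  countLess-high [] _ _ = refl
  countLess-high (b ∷ as) (b∉ ∷ u) (w≢b ∷ ws) with pairView m b
  ... | high e = ⊥-elim (w≢b (sym e))
  ... | low refl rewrite transpose-low m | ∉⇒memberᵇ v as b∉ | sym (countLess-high as u ws) | ∉⇒memberᵇ v as b∉
        | <⇒<ᵇ≡true (ℕP.n<1+n v) | ≮⇒<ᵇ≡false {w} {v} (ℕP.<-asym (ℕP.n<1+n v))
        | ≡⇒≡ᵇ≡true {v} refl =
          trans (ℕP.+-comm (countLess v (map s as)) 1) (cong suc (sym (ℕP.+-identityʳ (countLess v (map s as)))))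
  ... | other b≢v b≢w rewrite transpose-other m b b≢v b≢w | sym (<ᵇ-skipˡ v b b≢v b≢w) | sym (countLess-high as u ws)
        | ≢⇒≡ᵇ≡false {v} {b} (λ e → b≢v (sym e)) = ℕP.+-assoc (𝟙 (b <ᵇ w)) _ _

  even-inv-transpose : ∀ π → Unique π → even (inv (map s π)) ≡ (even (inv π) ≐ not (memberᵇ v π ∧ memberᵇ w π))
  even-inv-transpose [] _ = refl
  even-inv-transpose (a ∷ as) (a∉ ∷ u) with pairView m a
  ... | low refl rewrite transpose-low m | countLess-low as u a∉ | ≡⇒≡ᵇ≡true {v} refl
        | ≢⇒≡ᵇ≡false {w} {v} ℕP.1+n≢n =
      trans (even-+ (countLess v as + 𝟙 (memberᵇ w as)) (inv (map s as)))
      (trans (cong₂ _≐_ (trans (even-+ (countLess v as) (𝟙 (memberᵇ w as))) (cong (even (countLess v as) ≐_) (even-𝟙 (memberᵇ w as))))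
                        (trans (even-inv-transpose as u)
                          (trans (cong (λ z → even (inv as) ≐ not (z ∧ memberᵇ w as)) (∉⇒memberᵇ v as a∉)) (≐-identityʳ _))))
      (trans (≐-swapʳ (even (countLess v as)) (not (memberᵇ w as)) (even (inv as)))
      (cong (_≐ not (memberᵇ w as)) (sym (even-+ (countLess v as) (inv as))))))
  ... | high refl rewrite transpose-high m | ≡⇒≡ᵇ≡true {w} refl | ≢⇒≡ᵇ≡false {v} {w} (λ e → ℕP.1+n≢n (sym e))
        | BP.∧-identityʳ (memberᵇ v as) =
      trans (even-+ (countLess v (map s as)) (inv (map s as)))
      (trans (cong₂ _≐_ evenRank
                        (trans (even-inv-transpose as u)
                          (trans (cong (λ z → even (inv as) ≐ not (memberᵇ v as ∧ z)) (∉⇒memberᵇ w as a∉))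
                          (trans (cong (λ z → even (inv as) ≐ not z) (BP.∧-zeroʳ (memberᵇ v as))) (≐-identityʳ _)))))
      (trans (≐-swapʳ (even (countLess w as)) (not (memberᵇ v as)) (even (inv as)))
      (cong (_≐ not (memberᵇ v as)) (sym (even-+ (countLess w as) (inv as))))))
    where
    evenRank : even (countLess v (map s as)) ≡ (even (countLess w as) ≐ not (memberᵇ v as))
    evenRank = trans (sym (≐-cancelʳ (even (countLess v (map s as))) (not (memberᵇ v as))))
      (cong (_≐ not (memberᵇ v as)) (trans (cong (even (countLess v (map s as)) ≐_) (sym (even-𝟙 (memberᵇ v as))))
        (trans (sym (even-+ (countLess v (map s as)) (𝟙 (memberᵇ v as)))) (cong even (countLess-high as u a∉)))))
  ... | other a≢v a≢w rewrite transpose-other m a a≢v a≢w | ≢⇒≡ᵇ≡false {v} {a} (λ e → a≢v (sym e))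
        | ≢⇒≡ᵇ≡false {w} {a} (λ e → a≢w (sym e)) =
      trans (even-+ (countLess a (map s as)) (inv (map s as)))
      (trans (cong₂ _≐_ (cong even (trans (cong (λ z → countLess z (map s as)) (sym (transpose-other m a a≢v a≢w)))
                                          (countLess-other a as a≢v a≢w)))
                        (even-inv-transpose as u))
      (trans (≐-assoc (even (countLess a as)) (even (inv as)) _)
        (cong (_≐ not (memberᵇ v as ∧ memberᵇ w as)) (sym (even-+ (countLess a as) (inv as))))))

-- If K pairs all fail, each is adjacent at a position p ∈ {ℓ, ℓ + 1} with ℓ ∈ R, so it occupies
-- position ℓ + 1; hence different pairs give different ℓ, and K ≤ |R|.
module NoGoodPair (R π : List ℕ) (K : ℕ) (none : firstGoodPair (unreserved R) π 0 K ≡ nothing) where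
  private
    badAt : ℕ → ℕ
    badAt i = firstBadPosition (unreserved R) (double i) π 0

    window : ℕ → ℕ
    window i = firstSatisfying (λ ℓ → (badAt i ≡ᵇ ℓ) ∨ (badAt i ≡ᵇ suc ℓ)) R

    module _ (i : ℕ) (i<K : i < K) where
      spec = firstBadPosition-spec (unreserved R) (double i) π 0
               (firstGoodPair-nothing (unreserved R) π 0 K none i i<K)

      halves : ⌊ at π (badAt i) /2⌋ ≡ i × ⌊ at π (suc (badAt i)) /2⌋ ≡ i
      halves rewrite proj₁ (proj₂ spec) = isPair⇒⌊/2⌋ i _ _ (proj₁ (proj₂ (proj₂ spec)))

      badAt-reserved : ¬ T (unreserved R (badAt i))
      badAt-reserved = subst (λ z → ¬ T (unreserved R z)) (sym (proj₁ (proj₂ spec))) (proj₂ (proj₂ (proj₂ spec)))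

      window-spec : window i ∈ R × T ((badAt i ≡ᵇ window i) ∨ (badAt i ≡ᵇ suc (window i)))
      window-spec with reserved⇒∃ R (badAt i) badAt-reserved
      ... | ℓ , ℓ∈ , p = firstSatisfying-spec (λ ℓ → (badAt i ≡ᵇ ℓ) ∨ (badAt i ≡ᵇ suc ℓ)) R ℓ ℓ∈ p

      ⌊at-suc-window/2⌋ : ⌊ at π (suc (window i)) /2⌋ ≡ i
      ⌊at-suc-window/2⌋ with T-∨⁻ (proj₂ window-spec)
      ... | inj₁ p = subst (λ z → ⌊ at π (suc z) /2⌋ ≡ i) (ℕP.≡ᵇ⇒≡ _ _ p) (proj₂ halves)
      ... | inj₂ p = subst (λ z → ⌊ at π z /2⌋ ≡ i) (ℕP.≡ᵇ⇒≡ _ _ p) (proj₁ halves)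

    window-injective : ∀ i i′ → i < K → i′ < K → window i ≡ window i′ → i ≡ i′
    window-injective i i′ i< i′< eq =
      trans (sym (⌊at-suc-window/2⌋ i i<)) (trans (cong (λ z → ⌊ at π (suc z) /2⌋) eq) (⌊at-suc-window/2⌋ i′ i′<))

  K≤length : K ≤ length R
  K≤length = subst (_≤ length R) (trans (LP.length-map window (upTo K)) (LP.length-upTo K))
    (Unique-⊆⇒length≤ (map window (upTo K)) R
      (Unique-map⁺-injectiveOn window (upTo K) (UniqueP.upTo⁺ K)
        (λ i i′ i∈ i′∈ → window-injective i i′ (∈-upTo⁻ i∈) (∈-upTo⁻ i′∈)))
      (λ x x∈ → windowIn x∈))
    where
    windowIn : ∀ {x} → x ∈ map window (upTo K) → x ∈ R
    windowIn x∈ with ∈-map⁻ window x∈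
    ... | i , i∈ , refl = proj₁ (window-spec i (∈-upTo⁻ i∈))

∃goodPair : ∀ R π K → length R < K → ∃ λ m → firstGoodPair (unreserved R) π 0 K ≡ just m
∃goodPair R π K length<K with firstGoodPair (unreserved R) π 0 K in found
... | just m = m , refl
... | nothing = ⊥-elim (ℕP.<⇒≱ length<K (NoGoodPair.K≤length R π K found))

-- The reserved windows are the two end steps and the turn windows of L; k + 3 candidate pairs
-- outnumber the k + 2 windows, and the largest candidate 2(k + 2) + 1 still lies below n.
module PairSwap (n k : ℕ) (L : List ℕ) (length≤k : length L ≤ k) (2k+6≤n : 2 * k + 6 ≤ n) where
  K : ℕ
  K = suc (suc (suc k))

  reserved : List ℕ
  reserved = 0 ∷ (n ∸ 2) ∷ L

  free : ℕ → Bool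
  free = unreserved reserved

  swapIf : Maybe ℕ → List ℕ → List ℕ
  swapIf (just m) π = map (transpose m) π
  swapIf nothing π = π

  swapFirstGoodPair : List ℕ → List ℕ
  swapFirstGoodPair π = swapIf (firstGoodPair free π 0 K) π

  pair<n : ∀ m → m < K → suc (double m) < n
  pair<n m m<K = ℕP.≤-trans (s≤s (s≤s (double-mono (ℕP.≤-pred m<K))))
    (subst (_≤ n) (trans (ℕP.+-comm (2 * k) 6) (cong (6 ℕ.+_) (sym (double≡2* k)))) 2k+6≤n)

  endMoment-swapFirstGoodPair : ∀ ε → 2 ≤ n → endMoment ε n L ≡ endMoment (not ε) n L
  endMoment-swapFirstGoodPair ε 2≤n = endMoment-flip ε n L swapFirstGoodPair closed involutive weight parity
    where
    module _ (π : List ℕ) (π∈ : π ∈ perms n) where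
      isPermπ = ∈-perms⁻ n π π∈
      found = ∃goodPair reserved π K (s≤s (s≤s (s≤s length≤k)))
      m = proj₁ found
      spec = firstGoodPair-just free π 0 K m (proj₂ found)
      good = proj₁ spec
      m<K = proj₂ spec
      open TransposeLocally free m

      swaps : swapFirstGoodPair π ≡ map (transpose m) π
      swaps = cong (λ z → swapIf z π) (proj₂ found)

      closed : swapFirstGoodPair π ∈ perms n
      closed = subst (_∈ perms n) (sym swaps) (∈-perms⁺ n _ (map-transpose-IsPerm n m π (pair<n m m<K) isPermπ))

      involutive : swapFirstGoodPair (swapFirstGoodPair π) ≡ π
      involutive = trans (cong swapFirstGoodPair swaps)
        (trans (cong (λ z → swapIf z (map (transpose m) π)) (trans (firstGoodPair-transpose free m π 0 K) (proj₂ found)))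
        (map-transpose-involutive m π))

      endSign-transpose : ∀ σ → length σ ≡ n → T (pairOnlyAt free (double m) σ 0) →
        endSign (map (transpose m) σ) ≡ endSign σ
      endSign-transpose (a ∷ b ∷ r) refl good′ = cong₂ (λ x y → sign x ⊗ sign y)
        (firstAscent-transpose a b r good′ (proj₁ (unreserved-∈ reserved 0 (here refl))))
        (lastAscent-transpose (a ∷ b ∷ r) 0 (s≤s (s≤s z≤n)) good′ (proj₁ (unreserved-∈ reserved _ (there (here refl)))))
      endSign-transpose [] refl _ = ⊥-elim (ℕP.<⇒≱ 2≤n z≤n)
      endSign-transpose (a ∷ []) refl _ = ⊥-elim (ℕP.<⇒≱ 2≤n (s≤s z≤n))

      weight : turnProduct L (swapFirstGoodPair π) ⊗ endSign (swapFirstGoodPair π) ≡ turnProduct L π ⊗ endSign π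
      weight = trans (cong (λ z → turnProduct L z ⊗ endSign z) swaps)
        (cong₂ _⊗_ (turnProduct-transpose L π (λ ℓ ℓ∈ → unreserved-∈ reserved ℓ (there (there ℓ∈))) good)
                   (endSign-transpose π (IsPerm.len isPermπ) good))

      bothPresent : memberᵇ (double m) π ∧ memberᵇ (suc (double m)) π ≡ true
      bothPresent = cong₂ _∧_
        (∈⇒memberᵇ _ π (IsPerm⇒∈ isPermπ (double m) (ℕP.<-trans (ℕP.n<1+n _) (pair<n m m<K))))
        (∈⇒memberᵇ _ π (IsPerm⇒∈ isPermπ (suc (double m)) (pair<n m m<K)))

      parity : isEven (inv (swapFirstGoodPair π)) ≡ not (isEven (inv π))
      parity = trans (cong (λ z → isEven (inv z)) swaps) (trans (isEven≡even (inv (map (transpose m) π)))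
        (trans (TranspositionParity.even-inv-transpose m π (IsPerm.unq isPermπ))
        (trans (cong (λ z → even (inv π) ≐ not z) bothPresent)
        (trans (≐-not (even (inv π))) (cong not (sym (isEven≡even (inv π))))))))

endMoment-+ : ∀ n L → endMoment true n L ⊕ endMoment false n L ≡ ∑ (λ π → turnProduct L π ⊗ endSign π) (perms n)
endMoment-+ n L = trans (sym (∑-+ _ _ (perms n))) (∑-cong (perms n) (λ π _ →
  trans (sym (ℤP.*-distribʳ-+ (turnProduct L π ⊗ endSign π) (inClassℤ true π) (inClassℤ false π)))
  (trans (cong (_⊗ (turnProduct L π ⊗ endSign π)) (classes-partition π)) (ℤP.*-identityˡ _))))
  where
  classes-partition : ∀ π → inClassℤ true π ⊕ inClassℤ false π ≡ + 1
  classes-partition π with isEven (inv π)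
  ... | true = refl
  ... | false = refl

endMoment≡0 : ∀ n L → endMoment true n L ≡ endMoment false n L →
  ∑ (λ π → turnProduct L π ⊗ endSign π) (perms n) ≡ + 0 → ∀ ε → endMoment ε n L ≡ + 0
endMoment≡0 n L classesAgree total≡0 = λ { true → true≡0 ; false → trans (sym classesAgree) true≡0 }
  where
  true≡0 : endMoment true n L ≡ + 0
  true≡0 = x+x≡0⇒x≡0 _ (trans (cong (endMoment true n L ⊕_) classesAgree) (trans (endMoment-+ n L) total≡0))

SizeCondition : ℕ → ℕ → Set
SizeCondition n k = ((n % 4 ≡ 0 ⊎ n % 4 ≡ 1) × 2 * k + 6 ≤ n) ⊎ ((n % 4 ≡ 2 ⊎ n % 4 ≡ 3) × 2 * k + 4 ≤ n)

SizeCondition⇒2k+4≤n : ∀ n k → SizeCondition n k → 2 * k + 4 ≤ n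
SizeCondition⇒2k+4≤n n k (inj₁ (_ , 2k+6≤n)) = ℕP.≤-trans (ℕP.+-monoʳ-≤ (2 * k) (ℕP.m≤m+n 4 2)) 2k+6≤n
SizeCondition⇒2k+4≤n n k (inj₂ (_ , 2k+4≤n)) = 2k+4≤n

endMoment-classesAgree : ∀ n k → SizeCondition n k → 2 ≤ n →
  ∀ L → length L ≤ k → endMoment true n L ≡ endMoment false n L
endMoment-classesAgree n k (inj₁ (_ , 2k+6≤n)) 2≤n L length≤k =
  PairSwap.endMoment-swapFirstGoodPair n k L length≤k 2k+6≤n true 2≤n
endMoment-classesAgree (suc m) k (inj₂ (n%4 , _)) 2≤n L _ =
  Reflection.endMoment-reflectAll m true L 2≤n (triangle-odd (suc m) n%4)

theorem5 : (n k : ℕ) → 1 ≤ n → 1 ≤ k →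
    (((n % 4 ≡ 0 ⊎ n % 4 ≡ 1) × 2 * k + 6 ≤ n)
      ⊎ ((n % 4 ≡ 2 ⊎ n % 4 ≡ 3) × 2 * k + 4 ≤ n)) →
    (ε : Bool) → oddSum ε n k ≡ evenSum ε n k
theorem5 n k _ _ size ε =
  oddSum≡evenSum-if-moment≡0 ε n k 2≤n (moment≡0 ε n k 2≤n endMomentsVanish k [] ℕP.≤-refl)
  where
  2k+4≤n : 2 * k + 4 ≤ n
  2k+4≤n = SizeCondition⇒2k+4≤n n k size
  2≤n : 2 ≤ n
  2≤n = ℕP.≤-trans (ℕP.m≤n+m 2 (2 * k + 2)) (subst (_≤ n) (sym (ℕP.+-assoc (2 * k) 2 2)) 2k+4≤n)
  endMomentsVanish : ∀ L → length L ≤ k → endMoment ε n L ≡ + 0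
  endMomentsVanish L length≤k = endMoment≡0 n L (endMoment-classesAgree n k size 2≤n L length≤k)
                              (∑turnProduct⊗endSign≡0 n k L length≤k 2k+4≤n) ε
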